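{- Let $1 \le i \le n$, let $r \sim \mathcal{U}([n]^{[n]})$, let $G_r$ be the directed graph on $[n]$ with edges $(v, r(v))$, $v\in[n]$, and let $c(G_r)$ be its number of connected components. Then $$\frac{1}{4} i^{ -1/2} \le \mathbb{E}[2^{ -c(G_r)} \mid G_r \text{ has } i \text{ nodes in cycles}] \le i^{ -1/2}.$$
   Context: $[n]=\{1,\ldots,n\}$; $\mathcal{U}(X)$ is the uniform distribution on $X$. Each component of $G_r$ contains exactly one directed cycle (a loop counts as a cycle of length 1); a node is "in a cycle" if it lies on that cycle. -}

module Defs where

open import Data.Nat using (ℕ; zero; suc; _+_; _*_; _∸_; _^_; _<ᵇ_)
open import Data.Fin using (Fin; toℕ; _≟_)
open import Data.Bool using (Bool; true; false; _∧_; _∨_; not; if_then_else_)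
open import Data.List using (List; []; _∷_; map; concatMap; allFin; filterᵇ; length; upTo)
open import Data.Bool.ListAction using (any)
open import Data.Nat.ListAction using (sum)
open import Data.Vec using (Vec; lookup) renaming ([] to []ᵥ; _∷_ to _∷ᵥ_)
open import Relation.Nullary.Decidable using (⌊_⌋)

Map : ℕ → Set
Map n = Fin n → Fin n

allVecs : (n k : ℕ) → List (Vec (Fin n) k)
allVecs n zero    = []ᵥ ∷ []
allVecs n (suc k) = concatMap (λ v → map (λ a → a ∷ᵥ v) (allFin n)) (allVecs n k)

-- All n^n maps [n] → [n], each exactly once (support of 𝒰([n]^[n])).
allMaps : (n : ℕ) → List (Map n)
allMaps n = map lookup (allVecs n n)

iter : {A : Set} → (A → A) → ℕ → A → A
iter f zero    x = x
iter f (suc k) x = f (iter f k x)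

inCycle : {n : ℕ} → Map n → Fin n → Bool
inCycle {n} r v = any (λ k → ⌊ iter r (suc k) v ≟ v ⌋) (upTo n)

cycNodes : {n : ℕ} → Map n → ℕ
cycNodes {n} r = length (filterᵇ (inCycle r) (allFin n))

reachStep : {n : ℕ} → Map n → (Fin n → Bool) → (Fin n → Bool)
reachStep {n} r S w = S w ∨ S (r w) ∨ any (λ u → S u ∧ ⌊ r u ≟ w ⌋) (allFin n)

-- The (weakly) connected component of u in G_r, as a characteristic function.
component : {n : ℕ} → Map n → Fin n → (Fin n → Bool)
component {n} r u = iter (reachStep r) n (λ w → ⌊ w ≟ u ⌋)

isCompMin : {n : ℕ} → Map n → Fin n → Bool
isCompMin {n} r v = not (any (λ u → component r v u ∧ (toℕ u <ᵇ toℕ v)) (allFin n))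

-- c(G_r): number of connected components (= number of component minima)
numComponents : {n : ℕ} → Map n → ℕ
numComponents {n} r = length (filterᵇ (isCompMin r) (allFin n))

mapsWithCyc : (n i : ℕ) → List (Map n)
mapsWithCyc n i = filterᵇ (λ r → ⌊ Data.Nat._≟_ (cycNodes r) i ⌋) (allMaps n)

-- 2^n · Σ_{r in event} 2^{-c(G_r)}  (c ≤ n, so the truncated ∸ is exact)
scaledSum : (n i : ℕ) → ℕ
scaledSum n i = sum (map (λ r → 2 ^ (n ∸ numComponents r)) (mapsWithCyc n i))

-- number of maps in the event; then
-- E[2^{-c(G_r)} | i nodes in cycles] = scaledSum n i / (2^n * eventSize n i)
eventSize : (n i : ℕ) → ℕ
eventSize n i = length (mapsWithCyc n i)

{-# OPTIONS --safe #-}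
-- Order the cyclic nodes of a map r : [n] → [n] by index and let layer k consist of the maps with i
-- cyclic nodes whose cyclic nodes of rank ≥ k are fixed points. Layer i is the conditioning event; in
-- layer 0 each component carries exactly one cycle, a fixed point, so c(G_r) = i there. A map of layer
-- k + 1 outside layer k has its node m of rank k on a longer cycle, entered from a unique node of rank
-- t < k, and exchanging the images of these two nodes cuts m out as a fixed point: for each t this is a
-- bijection onto layer k adding one component. Hence layer k + 1 has k + 1 times as many maps as layer
-- k but 2k + 1 times its total weight 2^(−c), so the conditional expectation is (2i − 1)!! / (2i)!!,
-- which Wallis-type estimates place between 1/(2√i) and 1/√(2i + 1).
module Submission where

open import Defs
open import Algebra.Properties.CommutativeSemigroup using ()
open import Data.Bool using (Bool; true; false; _∧_; _∨_; not; T; if_then_else_)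
open import Data.Bool.ListAction using (any; or)
open import Data.Bool.Properties using (T-≡; ∧-identityʳ) renaming (_≟_ to _≟ᵇ_)
open import Data.Empty using (⊥; ⊥-elim)
open import Data.Fin using (Fin; toℕ; fromℕ<; _≟_) renaming (zero to fzero; suc to fsuc)
open import Data.Fin.Permutation.Components using (transpose)
import Data.Fin.Properties as Fin
open import Data.List using (List; []; _∷_; map; filterᵇ; length; allFin; upTo)
import Data.List.Properties as List
open import Data.List.Membership.Propositional using (_∈_)
open import Data.List.Membership.Propositional.Properties
  using (∈-filter⁺; ∈-filter⁻; ∈-map⁺; ∈-map⁻; ∈-allFin; ∈-concatMap⁺; ∈-upTo⁺)
open import Data.List.Membership.Propositional.Properties.WithK using (unique∧set⇒bag)
open import Data.List.Relation.Binary.BagAndSetEquality using (∼bag⇒↭)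
open import Data.List.Relation.Binary.Permutation.Propositional using (_↭_)
import Data.List.Relation.Binary.Permutation.Propositional.Properties as Perm
open import Data.List.Relation.Unary.All as All using ()
import Data.List.Relation.Unary.All.Properties as All
open import Data.List.Relation.Unary.Any as Any using (here; there)
open import Data.List.Relation.Unary.AllPairs as AllPairs using ([]; _∷_)
import Data.List.Relation.Unary.AllPairs.Properties as AllPairs
open import Data.List.Relation.Unary.Unique.Propositional using (Unique)
open import Data.List.Relation.Unary.Unique.Propositional.Properties
  using (allFin⁺; concat⁺; filter⁺) renaming (map⁺ to unique-map⁺)
open import Data.Nat as ℕ
  using (ℕ; zero; suc; _+_; _*_; _^_; _∸_; _!; _≤_; _<_; _<ᵇ_; _≤?_; _<?_; z≤n; s≤s; s≤s⁻¹; NonZero)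
open import Data.Nat.ListAction using (sum)
open import Data.Nat.ListAction.Properties using (sum-↭)
open import Data.Nat.Properties
  using (*-assoc; *-cancelˡ-≤; *-comm; *-distribˡ-+; *-identityʳ; *-identityˡ; *-mono-≤; *-monoʳ-≤; *-monoˡ-≤;
         *-zeroʳ; +-comm; +-identityʳ; +-suc; +-∸-assoc; <-cmp; <-irrefl; <-trans; <-≤-trans; <ᵇ⇒<; <⇒<ᵇ; <⇒≢;
         <⇒≤; ^-distribˡ-+-*; m*n≢0; m+[n∸m]≡n; m<n⇒m<1+n; m^n≢0; m≤n*m; m≤n+m; m≤n⇒∃[o]m+o≡n; n<1+n;
         n≤1+n; n≮0; ≤-<-trans; ≤-antisym; ≤-refl; ≤-reflexive; ≤-trans; ≤⇒≯; ≤∧≢⇒<; ≰⇒>; _!≢0;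
         +-commutativeSemigroup; module ≤-Reasoning)
open import Data.Nat.Tactic.RingSolver using (solve-∀)
open import Data.Product using (∃-syntax; _×_; _,_; proj₁; proj₂)
open import Data.Sum using (_⊎_; inj₁; inj₂)
open import Data.Vec using (Vec; lookup; tabulate) renaming ([] to []ᵥ; _∷_ to _∷ᵥ_)
import Data.Vec.Properties as Vec
open import Function using (_∘_; case_of_)
open import Function.Bundles using (Equivalence; mk⇔; _⇔_)
open import Function.Properties.Equivalence using (⇔-isEquivalence)
open import Relation.Binary.Construct.Closure.Equivalence as EqClosure using (EqClosure)
open import Relation.Binary.Construct.Closure.ReflexiveTransitive using (ε; _◅_)
open import Relation.Binary.Construct.Closure.Symmetric using (fwd; bwd)
open import Relation.Binary.Definitions using (tri<; tri≈; tri>)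
open import Relation.Binary.PropositionalEquality
open import Relation.Binary.Structures using (IsEquivalence)
open import Relation.Nullary using (¬_; Dec; yes; no)
open import Relation.Nullary.Decidable using (⌊_⌋; T?; dec-true; dec-false; _×-dec_; _→-dec_)

open Algebra.Properties.CommutativeSemigroup +-commutativeSemigroup using () renaming (interchange to +-interchange)

private
  variable
    A : Set

bool-ext : ∀ {a b : Bool} → (a ≡ true → b ≡ true) → (b ≡ true → a ≡ true) → a ≡ b
bool-ext {true}  {true}  _ _ = refl
bool-ext {true}  {false} f _ = sym (f refl)
bool-ext {false} {true}  _ g = g refl
bool-ext {false} {false} _ _ = refl

∧≡true⁻ : ∀ a {b} → a ∧ b ≡ true → a ≡ true × b ≡ true
∧≡true⁻ true refl = refl , refl

∧≡true⁺ : ∀ {a b} → a ≡ true → b ≡ true → a ∧ b ≡ true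
∧≡true⁺ refl refl = refl

∧≡falseʳ : ∀ a {b} → b ≡ false → a ∧ b ≡ false
∧≡falseʳ true  refl = refl
∧≡falseʳ false _    = refl

∨≡true⁻ : ∀ a {b} → a ∨ b ≡ true → a ≡ true ⊎ b ≡ true
∨≡true⁻ true  _ = inj₁ refl
∨≡true⁻ false e = inj₂ e

∨≡true⁺ˡ : ∀ {a} b → a ≡ true → a ∨ b ≡ true
∨≡true⁺ˡ b refl = refl

∨≡true⁺ʳ : ∀ a {b} → b ≡ true → a ∨ b ≡ true
∨≡true⁺ʳ true  _ = refl
∨≡true⁺ʳ false e = e

⌊⌋-sound : ∀ {P : Set} (d : Dec P) → ⌊ d ⌋ ≡ true → P
⌊⌋-sound (yes p) _ = p

⌊⌋-complete : ∀ {P : Set} (d : Dec P) → P → ⌊ d ⌋ ≡ true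
⌊⌋-complete (yes _) _ = refl
⌊⌋-complete (no ¬p) p = ⊥-elim (¬p p)

⌊⌋-false : ∀ {P : Set} (d : Dec P) → ¬ P → ⌊ d ⌋ ≡ false
⌊⌋-false (yes p) ¬p = ⊥-elim (¬p p)
⌊⌋-false (no _)  _  = refl

⌊⌋-false⁻ : ∀ {P : Set} (d : Dec P) → ⌊ d ⌋ ≡ false → ¬ P
⌊⌋-false⁻ (no ¬p) _ = ¬p

any≡true⁺ : (p : A → Bool) {x : A} (xs : List A) → x ∈ xs → p x ≡ true → any p xs ≡ true
any≡true⁺ p (y ∷ xs) (here refl) px = ∨≡true⁺ˡ (any p xs) px
any≡true⁺ p (y ∷ xs) (there x∈xs) px = ∨≡true⁺ʳ (p y) (any≡true⁺ p xs x∈xs px)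

any≡true⁻ : (p : A → Bool) (xs : List A) → any p xs ≡ true → ∃[ x ] x ∈ xs × p x ≡ true
any≡true⁻ p (y ∷ xs) e with ∨≡true⁻ (p y) e
... | inj₁ py = y , here refl , py
... | inj₂ rest with any≡true⁻ p xs rest
...   | x , x∈xs , px = x , there x∈xs , px

any-cong : ∀ {p q : A → Bool} → (∀ x → p x ≡ q x) → ∀ xs → any p xs ≡ any q xs
any-cong p≗q xs = cong or (List.map-cong p≗q xs)

count : (A → Bool) → List A → ℕ
count p xs = length (filterᵇ p xs)

count-cong : (p q : A → Bool) (xs : List A) → (∀ {x} → x ∈ xs → p x ≡ q x) → count p xs ≡ count q xs
count-cong p q []       _ = refl
count-cong p q (x ∷ xs) h with p x | q x | h (here refl)
... | true  | true  | _ = cong suc (count-cong p q xs (h ∘ there))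
... | false | false | _ = count-cong p q xs (h ∘ there)

count-≥1 : (p : A → Bool) {x : A} (xs : List A) → x ∈ xs → p x ≡ true → 1 ≤ count p xs
count-≥1 p (y ∷ xs) (here refl) px rewrite px = s≤s z≤n
count-≥1 p (y ∷ xs) (there x∈xs) px with p y
... | true  = s≤s z≤n
... | false = count-≥1 p xs x∈xs px

count-⊆ : (p q : A → Bool) → (∀ x → p x ≡ true → q x ≡ true) → (xs : List A) →
          (∀ {x} → x ∈ xs → q x ≡ p x) ⊎ suc (count p xs) ≤ count q xs
count-⊆ p q p⊆q [] = inj₁ λ ()
count-⊆ p q p⊆q (x ∷ xs) with p x in px | q x in qx | count-⊆ p q p⊆q xs
... | true  | false | _ with () ← trans (sym (p⊆q x px)) qx
... | true  | true  | inj₂ lt = inj₂ (s≤s lt)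
... | false | true  | inj₂ lt = inj₂ (≤-trans lt (n≤1+n _))
... | false | false | inj₂ lt = inj₂ lt
... | true  | true  | inj₁ eq = inj₁ λ { (here refl) → trans qx (sym px) ; (there x∈xs) → eq x∈xs }
... | false | false | inj₁ eq = inj₁ λ { (here refl) → trans qx (sym px) ; (there x∈xs) → eq x∈xs }
... | false | true  | inj₁ eq = inj₂ (s≤s (≤-reflexive (count-cong p q xs (sym ∘ eq))))

count-insert : (p q : A → Bool) (z : A) → q z ≡ true → p z ≡ false → (∀ x → x ≢ z → q x ≡ p x) →
               (xs : List A) → Unique xs → z ∈ xs → count q xs ≡ suc (count p xs)
count-insert p q z qz pz q≈p (x ∷ xs) (z∉xs ∷ _) (here refl) rewrite qz | pz =
  cong suc (count-cong q p xs λ x∈xs → q≈p _ λ { refl → All.lookup z∉xs x∈xs refl })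
count-insert p q z qz pz q≈p (x ∷ xs) (x∉xs ∷ uxs) (there z∈xs)
  rewrite q≈p x (λ { refl → All.lookup x∉xs z∈xs refl }) with p x
... | true  = cong suc (count-insert p q z qz pz q≈p xs uxs z∈xs)
... | false = count-insert p q z qz pz q≈p xs uxs z∈xs

count-allFin-≤ : ∀ {n} (p : Fin n → Bool) → count p (allFin n) ≤ n
count-allFin-≤ {n} p = ≤-trans (List.length-filter _ (allFin n)) (≤-reflexive (List.length-tabulate (λ x → x)))

allVecs-complete : ∀ n k (v : Vec (Fin n) k) → v ∈ allVecs n k
allVecs-complete n zero    []ᵥ        = here refl
allVecs-complete n (suc k) (a ∷ᵥ v) = ∈-concatMap⁺ (λ w → map (_∷ᵥ w) (allFin n))
  (Any.map (λ { refl → ∈-map⁺ (_∷ᵥ v) (∈-allFin a) }) (allVecs-complete n k v))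

allVecs-unique : ∀ n k → Unique (allVecs n k)
allVecs-unique n zero    = All.[] ∷ []
allVecs-unique n (suc k) = concat⁺
  (All.map⁺ (All.tabulate (λ _ → unique-map⁺ Vec.∷-injectiveˡ (allFin⁺ n))))
  (AllPairs.map⁺ (AllPairs.map disjoint (allVecs-unique n k)))
  where
    disjoint : ∀ {v w} → v ≢ w → ∀ {x} → x ∈ map (_∷ᵥ v) (allFin n) × x ∈ map (_∷ᵥ w) (allFin n) → ⊥
    disjoint v≢w (x∈v , x∈w) with ∈-map⁻ _ x∈v | ∈-map⁻ _ x∈w
    ... | _ , _ , refl | _ , _ , e = v≢w (Vec.∷-injectiveʳ e)

unique-map⁺-local : ∀ {A B : Set} (f : A → B) {xs : List A} → (∀ {x y} → x ∈ xs → y ∈ xs → f x ≡ f y → x ≡ y) →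
                    Unique xs → Unique (map f xs)
unique-map⁺-local f _ [] = []
unique-map⁺-local f f-inj (x∉xs ∷ uxs) =
  All.map⁺ (All.tabulate (λ y∈xs fx≡fy → All.lookup x∉xs y∈xs (f-inj (here refl) (there y∈xs) fx≡fy)))
  ∷ unique-map⁺-local f (λ x∈ y∈ → f-inj (there x∈) (there y∈)) uxs

module _ {A : Set} {L : List A} (L-unique : Unique L) (L-complete : ∀ x → x ∈ L) where

  private
    P? : (P : A → Bool) → ∀ x → Dec (T (P x))
    P? P x = T? (P x)

    filter-true : ∀ (P : A → Bool) {x} → x ∈ filterᵇ P L → P x ≡ true
    filter-true P x∈ = Equivalence.to T-≡ (proj₂ (∈-filter⁻ (P? P) {xs = L} x∈))

    ∈-filter : ∀ (P : A → Bool) {x} → P x ≡ true → x ∈ filterᵇ P L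
    ∈-filter P px = ∈-filter⁺ (P? P) (L-complete _) (Equivalence.from T-≡ px)

  filter-↭-map : ∀ (P Q : A → Bool) (f g : A → A) →
    (∀ x → P x ≡ true → Q (g x) ≡ true × f (g x) ≡ x) →
    (∀ y → Q y ≡ true → P (f y) ≡ true × g (f y) ≡ y) →
    filterᵇ P L ↭ map f (filterᵇ Q L)
  filter-↭-map P Q f g PQ QP = ∼bag⇒↭ (unique∧set⇒bag (filter⁺ (P? P) L-unique)
    (unique-map⁺-local f f-injective (filter⁺ (P? Q) L-unique))
    (mk⇔ (λ x∈ → let px = filter-true P x∈ in
                  subst (_∈ map f (filterᵇ Q L)) (proj₂ (PQ _ px)) (∈-map⁺ f (∈-filter Q (proj₁ (PQ _ px)))))
         (λ x∈ → let (y , y∈ , x≡fy) = ∈-map⁻ f x∈ in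
                  subst (_∈ filterᵇ P L) (sym x≡fy) (∈-filter P (proj₁ (QP y (filter-true Q y∈)))))))
    where
      f-injective : ∀ {x y} → x ∈ filterᵇ Q L → y ∈ filterᵇ Q L → f x ≡ f y → x ≡ y
      f-injective x∈ y∈ fx≡fy = trans (sym (proj₂ (QP _ (filter-true Q x∈))))
                                      (trans (cong g fx≡fy) (proj₂ (QP _ (filter-true Q y∈))))

module _ {A : Set} where

  sum-map-cong : ∀ {f g : A → ℕ} → (∀ x → f x ≡ g x) → ∀ xs → sum (map f xs) ≡ sum (map g xs)
  sum-map-cong f≗g xs = cong sum (List.map-cong f≗g xs)

  sum-map-+ : ∀ (f g : A → ℕ) xs → sum (map (λ x → f x + g x) xs) ≡ sum (map f xs) + sum (map g xs)
  sum-map-+ f g []       = refl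
  sum-map-+ f g (x ∷ xs) rewrite sum-map-+ f g xs = +-interchange (f x) (g x) _ _

  sum-map-* : ∀ a (f : A → ℕ) xs → sum (map (λ x → a * f x) xs) ≡ a * sum (map f xs)
  sum-map-* a f []       = sym (*-zeroʳ a)
  sum-map-* a f (x ∷ xs) = trans (cong (a * f x +_) (sum-map-* a f xs)) (sym (*-distribˡ-+ a (f x) _))

  sum-map-1 : ∀ (xs : List A) → sum (map (λ _ → 1) xs) ≡ length xs
  sum-map-1 []       = refl
  sum-map-1 (x ∷ xs) = cong suc (sum-map-1 xs)

  sum-filterᵇ : ∀ (P : A → Bool) (F : A → ℕ) xs →
                sum (map F (filterᵇ P xs)) ≡ sum (map (λ x → if P x then F x else 0) xs)
  sum-filterᵇ P F []       = refl
  sum-filterᵇ P F (x ∷ xs) with P x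
  ... | true  = cong (F x +_) (sum-filterᵇ P F xs)
  ... | false = sum-filterᵇ P F xs

filterᵇ-map : ∀ {A B : Set} (P : B → Bool) (f : A → B) xs → filterᵇ P (map f xs) ≡ map f (filterᵇ (λ x → P (f x)) xs)
filterᵇ-map P f []       = refl
filterᵇ-map P f (x ∷ xs) with P (f x)
... | true  = cong (f x ∷_) (filterᵇ-map P f xs)
... | false = filterᵇ-map P f xs

Σ< : ℕ → (ℕ → ℕ) → ℕ
Σ< zero    f = 0
Σ< (suc k) f = Σ< k f + f k

Σ<-cong : ∀ k {f g} → (∀ t → t < k → f t ≡ g t) → Σ< k f ≡ Σ< k g
Σ<-cong zero    f≗g = refl
Σ<-cong (suc k) f≗g = cong₂ _+_ (Σ<-cong k (λ t t<k → f≗g t (m<n⇒m<1+n t<k))) (f≗g k ≤-refl)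

Σ<-const : ∀ k X → Σ< k (λ _ → X) ≡ k * X
Σ<-const zero    X = refl
Σ<-const (suc k) X = trans (cong (_+ X) (Σ<-const k X)) (+-comm (k * X) X)

Σ<-zero : ∀ k {f} → (∀ t → t < k → f t ≡ 0) → Σ< k f ≡ 0
Σ<-zero k f≗0 = trans (Σ<-cong k f≗0) (trans (Σ<-const k 0) (*-zeroʳ k))

Σ<-single : ∀ k {f t₀} → t₀ < k → (∀ t → t < k → t ≢ t₀ → f t ≡ 0) → Σ< k f ≡ f t₀
Σ<-single (suc k) {f} {t₀} t₀<1+k others with t₀ ℕ.≟ k
... | yes refl = trans (cong (_+ f k) (Σ<-zero k (λ t t<k → others t (m<n⇒m<1+n t<k) (<⇒≢ t<k)))) refl
... | no t₀≢k = trans (cong₂ _+_ (Σ<-single k (≤∧≢⇒< (s≤s⁻¹ t₀<1+k) t₀≢k) (λ t t<k → others t (m<n⇒m<1+n t<k)))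
                                 (others k ≤-refl (λ e → t₀≢k (sym e))))
                      (+-identityʳ _)

sum-Σ< : ∀ {A : Set} k (h : ℕ → A → ℕ) xs → sum (map (λ x → Σ< k (λ t → h t x)) xs) ≡ Σ< k (λ t → sum (map (h t) xs))
sum-Σ< zero    h xs = sum-map-* 0 (λ _ → 0) xs
sum-Σ< (suc k) h xs = trans (sum-map-+ (λ x → Σ< k (λ t → h t x)) (h k) xs) (cong (_+ sum (map (h k) xs)) (sum-Σ< k h xs))

if-split : ∀ {a₁ a₀ : Bool} {e : ℕ → Bool} k F →
  (a₁ ≡ true → (a₀ ≡ true × (∀ t → t < k → e t ≡ false)) ⊎
               (a₀ ≡ false × ∃[ t₀ ] t₀ < k × e t₀ ≡ true × (∀ t → t < k → t ≢ t₀ → e t ≡ false))) →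
  (a₁ ≡ false → a₀ ≡ false × (∀ t → t < k → e t ≡ false)) →
  (if a₁ then F else 0) ≡ (if a₀ then F else 0) + Σ< k (λ t → if e t then F else 0)
if-split {false} k F _ absent with absent refl
... | refl , none = sym (Σ<-zero k (λ t t<k → cong (if_then F else 0) (none t t<k)))
if-split {true} k F present _ with present refl
... | inj₁ (refl , none) = sym (trans (cong (F +_) (Σ<-zero k (λ t t<k → cong (if_then F else 0) (none t t<k))))
                                      (+-identityʳ F))
... | inj₂ (refl , t₀ , t₀<k , e₀ , others) =
  sym (trans (Σ<-single k t₀<k (λ t t<k t≢t₀ → cong (if_then F else 0) (others t t<k t≢t₀)))
             (cong (if_then F else 0) e₀))

sum-filterᵇ-cong : ∀ {A : Set} (P : A → Bool) {f g : A → ℕ} → (∀ x → P x ≡ true → f x ≡ g x) →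
                   ∀ xs → sum (map f (filterᵇ P xs)) ≡ sum (map g (filterᵇ P xs))
sum-filterᵇ-cong P f≗g []       = refl
sum-filterᵇ-cong P f≗g (x ∷ xs) with P x in px
... | true  = cong₂ _+_ (f≗g x px) (sum-filterᵇ-cong P f≗g xs)
... | false = sum-filterᵇ-cong P f≗g xs

-- Cyclic nodes

module _ {A : Set} (f : A → A) where

  iter-+ : ∀ a b x → iter f (a + b) x ≡ iter f a (iter f b x)
  iter-+ zero    b x = refl
  iter-+ (suc a) b x = cong f (iter-+ a b x)

  iter-suc : ∀ k x → iter f (suc k) x ≡ iter f k (f x)
  iter-suc zero    x = refl
  iter-suc (suc k) x = cong f (iter-suc k x)

  iter-periodic : ∀ p {x} → iter f p x ≡ x → ∀ q → iter f (q * p) x ≡ x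
  iter-periodic p e zero    = refl
  iter-periodic p e (suc q) = trans (iter-+ p (q * p) _) (trans (cong (iter f p) (iter-periodic p e q)) e)

  iter-fixed : ∀ {x} → f x ≡ x → ∀ k → iter f k x ≡ x
  iter-fixed e zero    = refl
  iter-fixed e (suc k) = trans (cong f (iter-fixed e k)) e

iter-cong : ∀ {A : Set} {f g : A → A} → (∀ x → f x ≡ g x) → ∀ k x → iter f k x ≡ iter g k x
iter-cong e zero    x = refl
iter-cong {f = f} e (suc k) x = trans (cong f (iter-cong e k x)) (e _)

module _ {n : ℕ} where

  Cyclic : Map n → Fin n → Set
  Cyclic r x = ∃[ k ] iter r (suc k) x ≡ x

  cyclic-cong : ∀ {r s : Map n} → (∀ x → r x ≡ s x) → ∀ {x} → Cyclic r x → Cyclic s x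
  cyclic-cong e (k , p) = k , trans (sym (iter-cong e (suc k) _)) p

  cyclic-step : ∀ (r : Map n) {x} → Cyclic r x → Cyclic r (r x)
  cyclic-step r {x} (k , p) = k , trans (sym (iter-suc r (suc k) x)) (cong r p)

  cyclic-iter : ∀ (r : Map n) k {x} → Cyclic r x → Cyclic r (iter r k x)
  cyclic-iter r zero    c = c
  cyclic-iter r (suc k) c = cyclic-step r (cyclic-iter r k c)

  orbit-repeats : ∀ (r : Map n) x → ∃[ a ] ∃[ b ] a < b × b ≤ n × iter r a x ≡ iter r b x
  orbit-repeats r x with Fin.pigeonhole (n<1+n n) (λ (j : Fin (suc n)) → iter r (toℕ j) x)
  ... | a , b , a<b , e = toℕ a , toℕ b , a<b , s≤s⁻¹ (Fin.toℕ<n b) , e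

  -- A map injective on a forward-closed set permutes it, so each of its points returns within n steps.
  module InjectiveOn (f : Map n) (K : Fin n → Set) (closed : ∀ {x} → K x → K (f x))
                     (injective : ∀ {x y} → K x → K y → f x ≡ f y → x ≡ y) where

    iter-closed : ∀ a {x} → K x → K (iter f a x)
    iter-closed zero    k = k
    iter-closed (suc a) k = closed (iter-closed a k)

    iter-injective : ∀ a {x y} → K x → K y → iter f a x ≡ iter f a y → x ≡ y
    iter-injective zero    kx ky e = e
    iter-injective (suc a) kx ky e = iter-injective a kx ky (injective (iter-closed a kx) (iter-closed a ky) e)

    return-within : ∀ {x} → K x → ∃[ d ] d < n × iter f (suc d) x ≡ x
    return-within {x} kx with orbit-repeats f x
    ... | a , b , a<b , b≤n , e with m≤n⇒∃[o]m+o≡n a<b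
    ...   | d , a+1+d≡b = d , d<n , sym (iter-injective a kx (iter-closed (suc d) kx) a-later)
      where
        d<n : d < n
        d<n = ≤-trans (s≤s (m≤n+m d a)) (≤-trans (≤-reflexive a+1+d≡b) b≤n)
        a-later : iter f a x ≡ iter f a (iter f (suc d) x)
        a-later = trans e (trans (cong (λ t → iter f t x) (trans (sym a+1+d≡b) (sym (+-suc a d))))
                                 (iter-+ f a (suc d) x))

  cyclic-injective : ∀ (r : Map n) {u v} → Cyclic r u → Cyclic r v → r u ≡ r v → u ≡ v
  cyclic-injective r {u} {v} (a , pu) (b , pv) e =
    begin
      u                          ≡⟨ sym (iter-periodic r (suc a) pu (suc b)) ⟩
      iter r (suc b * suc a) u   ≡⟨ iter-suc r (a + b * suc a) u ⟩
      iter r (a + b * suc a) (r u) ≡⟨ cong (iter r (a + b * suc a)) e ⟩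
      iter r (a + b * suc a) (r v) ≡⟨ sym (iter-suc r (a + b * suc a) v) ⟩
      iter r (suc b * suc a) v   ≡⟨ cong (λ t → iter r t v) (*-comm (suc b) (suc a)) ⟩
      iter r (suc a * suc b) v   ≡⟨ iter-periodic r (suc b) pv (suc a) ⟩
      v                          ∎
    where open ≡-Reasoning

  module OnCycles (r : Map n) = InjectiveOn r (Cyclic r) (cyclic-step r) (cyclic-injective r)

  inCycle-sound : ∀ (r : Map n) v → inCycle r v ≡ true → Cyclic r v
  inCycle-sound r v e with any≡true⁻ _ (upTo n) e
  ... | k , _ , p = k , ⌊⌋-sound (iter r (suc k) v ≟ v) p

  inCycle-complete : ∀ (r : Map n) v → Cyclic r v → inCycle r v ≡ true
  inCycle-complete r v c with OnCycles.return-within r c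
  ... | d , d<n , p = any≡true⁺ (λ k → ⌊ iter r (suc k) v ≟ v ⌋) (upTo n) (∈-upTo⁺ d<n)
                                 (⌊⌋-complete (iter r (suc d) v ≟ v) p)

  iter-n-cyclic : ∀ (r : Map n) x → Cyclic r (iter r n x)
  iter-n-cyclic r x with orbit-repeats r x
  ... | a , b , a<b , b≤n , e with m≤n⇒∃[o]m+o≡n a<b | m≤n⇒∃[o]m+o≡n (≤-trans (<⇒≤ a<b) b≤n)
  ...   | d , a+1+d≡b | c , a+c≡n = subst (Cyclic r) at-n (cyclic-iter r c at-a)
    where
      at-a : Cyclic r (iter r a x)
      at-a = d , trans (sym (iter-+ r (suc d) a x))
                       (trans (cong (λ t → iter r t x) (trans (+-comm (suc d) a) (trans (+-suc a d) a+1+d≡b)))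
                              (sym e))
      at-n : iter r c (iter r a x) ≡ iter r n x
      at-n = trans (sym (iter-+ r c a x)) (cong (λ t → iter r t x) (trans (+-comm c a) a+c≡n))

module _ {n : ℕ} where

  transpose-≡ˡ : ∀ (a b : Fin n) → transpose a b a ≡ b
  transpose-≡ˡ a b with a ≟ a
  ... | yes _   = refl
  ... | no a≢a = ⊥-elim (a≢a refl)

  transpose-≡ʳ : ∀ (a b : Fin n) → transpose a b b ≡ a
  transpose-≡ʳ a b with b ≟ a
  ... | yes refl = refl
  ... | no _ with b ≟ b
  ...   | yes _   = refl
  ...   | no b≢b = ⊥-elim (b≢b refl)

  transpose-≢ : ∀ (a b x : Fin n) → x ≢ a → x ≢ b → transpose a b x ≡ x
  transpose-≢ a b x x≢a x≢b with x ≟ a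
  ... | yes x≡a = ⊥-elim (x≢a x≡a)
  ... | no _ with x ≟ b
  ...   | yes x≡b = ⊥-elim (x≢b x≡b)
  ...   | no _    = refl

  transpose-preserves : ∀ (P : Fin n → Set) {a b x} → P a → P b → P x → P (transpose a b x)
  transpose-preserves P {a} {b} {x} pa pb px = by-cases (x ≟ a) (x ≟ b)
    where
      by-cases : Dec (x ≡ a) → Dec (x ≡ b) → P (transpose a b x)
      by-cases (yes refl) _          = subst P (sym (transpose-≡ˡ a b)) pb
      by-cases (no _)     (yes refl) = subst P (sym (transpose-≡ʳ a b)) pa
      by-cases (no x≢a)   (no x≢b)   = subst P (sym (transpose-≢ a b x x≢a x≢b)) px

  transpose-involutive : ∀ (a b x : Fin n) → transpose a b (transpose a b x) ≡ x
  transpose-involutive a b x = by-cases (x ≟ a) (x ≟ b)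
    where
      by-cases : Dec (x ≡ a) → Dec (x ≡ b) → transpose a b (transpose a b x) ≡ x
      by-cases (yes refl) _          = trans (cong (transpose a b) (transpose-≡ˡ a b)) (transpose-≡ʳ a b)
      by-cases (no _)     (yes refl) = trans (cong (transpose a b) (transpose-≡ʳ a b)) (transpose-≡ˡ a b)
      by-cases (no x≢a)   (no x≢b)   = trans (cong (transpose a b) (transpose-≢ a b x x≢a x≢b)) (transpose-≢ a b x x≢a x≢b)

  transpose-injective : ∀ (a b : Fin n) {x y} → transpose a b x ≡ transpose a b y → x ≡ y
  transpose-injective a b {x} {y} e =
    trans (sym (transpose-involutive a b x)) (trans (cong (transpose a b) e) (transpose-involutive a b y))

  Swapped : Map n → Map n → Fin n → Fin n → Set
  Swapped r r′ a b = ∀ x → r′ x ≡ r (transpose a b x)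

  swapped-sym : ∀ {r r′ : Map n} {a b} → Swapped r r′ a b → Swapped r′ r a b
  swapped-sym {r} {r′} {a} {b} sw x = trans (cong r (sym (transpose-involutive a b x))) (sym (sw _))

  -- r′ = r ∘ (a b) maps the cyclic nodes of r injectively into themselves, so they stay cyclic.
  swapped-cyclic : ∀ {r r′ : Map n} {a b} → Swapped r r′ a b → Cyclic r a → Cyclic r b →
                   ∀ {v} → Cyclic r v → Cyclic r′ v
  swapped-cyclic {r} {r′} {a} {b} sw ca cb cv with InjectiveOn.return-within r′ (Cyclic r) closed injective cv
    where
      closed : ∀ {x} → Cyclic r x → Cyclic r (r′ x)
      closed {x} cx = subst (Cyclic r) (sym (sw x)) (cyclic-step r (transpose-preserves (Cyclic r) ca cb cx))
      injective : ∀ {x y} → Cyclic r x → Cyclic r y → r′ x ≡ r′ y → x ≡ y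
      injective {x} {y} cx cy e = transpose-injective a b
        (cyclic-injective r (transpose-preserves (Cyclic r) ca cb cx) (transpose-preserves (Cyclic r) ca cb cy)
                            (trans (sym (sw x)) (trans e (sw y))))
  ... | d , _ , p = d , p

  inCycle-swapped : ∀ {r r′ : Map n} {a b} → Swapped r r′ a b → Cyclic r a → Cyclic r b →
                    ∀ v → inCycle r′ v ≡ inCycle r v
  inCycle-swapped {r} {r′} {a} {b} sw ca cb v = bool-ext
    (λ e → inCycle-complete r v (backward (inCycle-sound r′ v e)))
    (λ e → inCycle-complete r′ v (forward (inCycle-sound r v e)))
    where
      forward : ∀ {x} → Cyclic r x → Cyclic r′ x
      forward = swapped-cyclic {r} {r′} sw ca cb
      backward : ∀ {x} → Cyclic r′ x → Cyclic r x
      backward = swapped-cyclic {r′} {r} (swapped-sym {r} {r′} sw) (forward ca) (forward cb)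

  inCycle-cong : ∀ {r s : Map n} → (∀ x → r x ≡ s x) → ∀ v → inCycle r v ≡ inCycle s v
  inCycle-cong {r} {s} r≗s v = bool-ext
    (λ e → inCycle-complete s v (cyclic-cong r≗s (inCycle-sound r v e)))
    (λ e → inCycle-complete r v (cyclic-cong (λ x → sym (r≗s x)) (inCycle-sound s v e)))

  cycNodes-cong : ∀ {r s : Map n} → (∀ x → inCycle r x ≡ inCycle s x) → cycNodes r ≡ cycNodes s
  cycNodes-cong h = count-cong _ _ (allFin n) (λ {x} _ → h x)

-- Connected components

module _ {n : ℕ} where

  Linked : Map n → Fin n → Fin n → Set
  Linked r = EqClosure (λ u v → r u ≡ v)

  infixr 5 _∙_
  infix 8 _⁻¹

  _∙_ : ∀ {r : Map n} {u v w} → Linked r u v → Linked r v w → Linked r u w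
  _∙_ = EqClosure.transitive _

  _⁻¹ : ∀ {r : Map n} {u v} → Linked r u v → Linked r v u
  _⁻¹ = EqClosure.symmetric _

  edge : ∀ {r : Map n} u → Linked r u (r u)
  edge u = EqClosure.return refl

  linked-cong : ∀ {r s : Map n} → (∀ x → r x ≡ s x) → ∀ {u v} → Linked r u v → Linked s u v
  linked-cong r≗s = EqClosure.map (λ {u} e → trans (sym (r≗s u)) e)

  linked-iter : ∀ (r : Map n) k x → Linked r x (iter r k x)
  linked-iter r zero    x = ε
  linked-iter r (suc k) x = linked-iter r k x ∙ edge _

module Reach {n : ℕ} (r : Map n) (u : Fin n) where

  reach : ℕ → Fin n → Bool
  reach k = iter (reachStep r) k (λ w → ⌊ w ≟ u ⌋)

  Closed : (Fin n → Bool) → Set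
  Closed S = ∀ w → reachStep r S w ≡ S w

  reachStep-inflationary : ∀ S w → S w ≡ true → reachStep r S w ≡ true
  reachStep-inflationary S w = ∨≡true⁺ˡ _

  reachStep-cong : ∀ {S T} → (∀ x → S x ≡ T x) → ∀ w → reachStep r S w ≡ reachStep r T w
  reachStep-cong {S} {T} S≗T w rewrite S≗T w | S≗T (r w) =
    cong (λ b → T w ∨ T (r w) ∨ b) (any-cong (λ x → cong (_∧ _) (S≗T x)) (allFin n))

  -- Each step that is not yet stationary adds a vertex, so the iteration is stationary after n steps.
  grows-or-closed : ∀ k → suc k ≤ count (reach k) (allFin n) ⊎ Closed (reach k)
  grows-or-closed zero = inj₁ (count-≥1 _ (allFin n) (∈-allFin u) (⌊⌋-complete (u ≟ u) refl))
  grows-or-closed (suc k) with grows-or-closed k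
  ... | inj₂ closed = inj₂ (reachStep-cong closed)
  ... | inj₁ k<count with count-⊆ (reach k) (reach (suc k)) (reachStep-inflationary (reach k)) (allFin n)
  ...   | inj₁ same = inj₂ (reachStep-cong (λ w → same (∈-allFin w)))
  ...   | inj₂ grows = inj₁ (≤-trans (s≤s k<count) grows)

  reach-closed : Closed (reach n)
  reach-closed with grows-or-closed n
  ... | inj₂ closed = closed
  ... | inj₁ n<count = ⊥-elim (<-irrefl refl (≤-trans n<count (count-allFin-≤ (reach n))))

  reach-root : ∀ k → reach k u ≡ true
  reach-root zero    = ⌊⌋-complete (u ≟ u) refl
  reach-root (suc k) = reachStep-inflationary (reach k) u (reach-root k)

  reach-sound : ∀ k w → reach k w ≡ true → Linked r w u
  reach-sound zero w e with ⌊⌋-sound (w ≟ u) e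
  ... | refl = ε
  reach-sound (suc k) w e with ∨≡true⁻ (reach k w) e
  ... | inj₁ at-w = reach-sound k w at-w
  ... | inj₂ e′ with ∨≡true⁻ (reach k (r w)) e′
  ...   | inj₁ succ = fwd refl ◅ reach-sound k (r w) succ
  ...   | inj₂ pred with any≡true⁻ _ (allFin n) pred
  ...     | v , _ , e″ with ∧≡true⁻ (reach k v) e″
  ...       | rv , v↦w = bwd (⌊⌋-sound (r v ≟ w) v↦w) ◅ reach-sound k v rv

  reach-complete : ∀ {w} → Linked r w u → reach n w ≡ true
  reach-complete ε = reach-root n
  reach-complete {w} (fwd refl ◅ p) =
    trans (sym (reach-closed w)) (∨≡true⁺ʳ (reach n w) (∨≡true⁺ˡ _ (reach-complete p)))
  reach-complete (_◅_ {j = v} (bwd refl) p) =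
    trans (sym (reach-closed (r v))) (∨≡true⁺ʳ (reach n (r v)) (∨≡true⁺ʳ (reach n (r (r v)))
      (any≡true⁺ _ (allFin n) (∈-allFin v) (∧≡true⁺ (reach-complete p) (⌊⌋-complete (r v ≟ r v) refl)))))

module _ {n : ℕ} where

  component-sound : ∀ (r : Map n) {u w} → component r u w ≡ true → Linked r w u
  component-sound r {u} {w} = Reach.reach-sound r u n w

  component-complete : ∀ (r : Map n) {u w} → Linked r w u → component r u w ≡ true
  component-complete r {u} = Reach.reach-complete r u

least : ∀ {n} (P : Fin n → Bool) {x} → P x ≡ true → ∃[ y ] P y ≡ true × (∀ z → P z ≡ true → toℕ y ≤ toℕ z)
least {suc n} P {x} px with P fzero in p0
... | true = fzero , p0 , λ _ _ → z≤n
... | false with x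
...   | fzero with () ← trans (sym px) p0
...   | fsuc x′ with least (λ z → P (fsuc z)) px
...     | y , py , y-least = fsuc y , py , λ where
            fzero    pz → case trans (sym pz) p0 of λ ()
            (fsuc z) pz → s≤s (y-least z pz)

module _ {n : ℕ} where

  IsComponentMin : Map n → Fin n → Set
  IsComponentMin r v = ∀ u → Linked r u v → toℕ v ≤ toℕ u

  isCompMin-sound : ∀ (r : Map n) v → isCompMin r v ≡ true → IsComponentMin r v
  isCompMin-sound r v e u u~v with toℕ v ≤? toℕ u
  ... | yes v≤u = v≤u
  ... | no v≰u with () ← trans (sym e) (cong not (any≡true⁺ _ (allFin n) (∈-allFin u)
                          (∧≡true⁺ (component-complete r u~v) (Equivalence.to T-≡ (<⇒<ᵇ (≰⇒> v≰u))))))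

  isCompMin-complete : ∀ (r : Map n) v → IsComponentMin r v → isCompMin r v ≡ true
  isCompMin-complete r v v-min with any (λ u → component r v u ∧ (toℕ u <ᵇ toℕ v)) (allFin n) in e
  ... | false = refl
  ... | true with any≡true⁻ _ (allFin n) e
  ...   | u , _ , e′ with ∧≡true⁻ (component r v u) e′
  ...     | u~v , u<v = ⊥-elim (<-irrefl refl (≤-<-trans (v-min u (component-sound r u~v))
                                                          (<ᵇ⇒< _ _ (Equivalence.from T-≡ u<v))))

  componentMin : Map n → Fin n → Fin n
  componentMin r x = proj₁ (least (component r x) (component-complete r ε))

  componentMin-linked : ∀ (r : Map n) x → Linked r (componentMin r x) x
  componentMin-linked r x = component-sound r (proj₁ (proj₂ (least (component r x) (component-complete r ε))))

  componentMin-≤ : ∀ (r : Map n) {x u} → Linked r u x → toℕ (componentMin r x) ≤ toℕ u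
  componentMin-≤ r {x} {u} u~x = proj₂ (proj₂ (least (component r x) (component-complete r ε))) u (component-complete r u~x)

  componentMin-isMin : ∀ (r : Map n) x → IsComponentMin r (componentMin r x)
  componentMin-isMin r x u u~m = componentMin-≤ r (u~m ∙ componentMin-linked r x)

  componentMin-unique : ∀ (r : Map n) {v x} → IsComponentMin r v → Linked r v x → componentMin r x ≡ v
  componentMin-unique r v-min v~x = Fin.toℕ-injective
    (≤-antisym (componentMin-≤ r v~x) (v-min _ (componentMin-linked r _ ∙ (v~x ⁻¹))))

  isCompMin-cong : ∀ {r s : Map n} → (∀ x → r x ≡ s x) → ∀ v → isCompMin r v ≡ isCompMin s v
  isCompMin-cong {r} {s} r≗s v = bool-ext
    (λ e → isCompMin-complete s v (λ u p → isCompMin-sound r v e u (linked-cong (λ x → sym (r≗s x)) p)))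
    (λ e → isCompMin-complete r v (λ u p → isCompMin-sound s v e u (linked-cong r≗s p)))

  numComponents-cong : ∀ {r s : Map n} → (∀ x → r x ≡ s x) → numComponents r ≡ numComponents s
  numComponents-cong r≗s = count-cong _ _ (allFin n) (λ {v} _ → isCompMin-cong r≗s v)

  numComponents-≤ : ∀ (r : Map n) → numComponents r ≤ n
  numComponents-≤ r = count-allFin-≤ (isCompMin r)

  Bridged : Map n → Fin n → Fin n → Fin n → Fin n → Set
  Bridged r a b u v = Linked r u v ⊎ (Linked r u a × Linked r b v) ⊎ (Linked r u b × Linked r a v)

  bridged-flip : ∀ {r : Map n} {a b u v} → Bridged r a b u v → Bridged r b a u v
  bridged-flip (inj₁ p)        = inj₁ p
  bridged-flip (inj₂ (inj₁ q)) = inj₂ (inj₂ q)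
  bridged-flip (inj₂ (inj₂ q)) = inj₂ (inj₁ q)

  bridged-isEquivalence : ∀ (r : Map n) a b → IsEquivalence (Bridged r a b)
  bridged-isEquivalence r a b = record { refl = inj₁ ε ; sym = sym′ ; trans = trans′ }
    where
      sym′ : ∀ {u v} → Bridged r a b u v → Bridged r a b v u
      sym′ (inj₁ p)               = inj₁ (p ⁻¹)
      sym′ (inj₂ (inj₁ (p , q)))  = inj₂ (inj₂ (q ⁻¹ , p ⁻¹))
      sym′ (inj₂ (inj₂ (p , q)))  = inj₂ (inj₁ (q ⁻¹ , p ⁻¹))

      trans′ : ∀ {u v w} → Bridged r a b u v → Bridged r a b v w → Bridged r a b u w
      trans′ (inj₁ p)              (inj₁ q)              = inj₁ (p ∙ q)
      trans′ (inj₁ p)              (inj₂ (inj₁ (q , q′))) = inj₂ (inj₁ (p ∙ q , q′))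
      trans′ (inj₁ p)              (inj₂ (inj₂ (q , q′))) = inj₂ (inj₂ (p ∙ q , q′))
      trans′ (inj₂ (inj₁ (p , p′))) (inj₁ q)              = inj₂ (inj₁ (p , p′ ∙ q))
      trans′ (inj₂ (inj₁ (p , p′))) (inj₂ (inj₁ (q , q′))) = inj₂ (inj₁ (p , q′))
      trans′ (inj₂ (inj₁ (p , p′))) (inj₂ (inj₂ (q , q′))) = inj₁ (p ∙ q′)
      trans′ (inj₂ (inj₂ (p , p′))) (inj₁ q)              = inj₂ (inj₂ (p , p′ ∙ q))
      trans′ (inj₂ (inj₂ (p , p′))) (inj₂ (inj₁ (q , q′))) = inj₁ (p ∙ q′)
      trans′ (inj₂ (inj₂ (p , p′))) (inj₂ (inj₂ (q , q′))) = inj₂ (inj₂ (p , q′))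

  private
    module SplitOrdered (r r′ : Map n) (a b : Fin n)
        (r⊆bridged : ∀ {u v} → Linked r u v → Bridged r′ a b u v)
        (r′⊆r : ∀ {u v} → Linked r′ u v → Linked r u v)
        (a~b : Linked r a b)
        (a<b : toℕ (componentMin r′ a) < toℕ (componentMin r′ b)) where

      z : Fin n
      z = componentMin r′ b

      min-preserved : ∀ v → IsComponentMin r v → IsComponentMin r′ v
      min-preserved v v-min u u~v = v-min u (r′⊆r u~v)

      min-reflected : ∀ v → v ≢ z → IsComponentMin r′ v → IsComponentMin r v
      min-reflected v v≢z v-min u u~v with r⊆bridged u~v
      ... | inj₁ u~′v = v-min u u~′v
      ... | inj₂ (inj₁ (_ , b~v)) = ⊥-elim (v≢z (sym (componentMin-unique r′ v-min (b~v ⁻¹))))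
      ... | inj₂ (inj₂ (u~b , a~v)) rewrite sym (componentMin-unique r′ v-min (a~v ⁻¹)) =
        ≤-trans (<⇒≤ a<b) (componentMin-≤ r′ u~b)

      z-not-min : ¬ IsComponentMin r z
      z-not-min z-min = <-irrefl refl (<-≤-trans a<b (z-min (componentMin r′ a)
        (r′⊆r (componentMin-linked r′ a) ∙ (a~b ∙ r′⊆r (componentMin-linked r′ b ⁻¹)))))

      components : numComponents r′ ≡ suc (numComponents r)
      components = count-insert (isCompMin r) (isCompMin r′) z
        (isCompMin-complete r′ z (componentMin-isMin r′ b)) z-not-isCompMin
        (λ v v≢z → bool-ext (λ e → isCompMin-complete r v (min-reflected v v≢z (isCompMin-sound r′ v e)))
                            (λ e → isCompMin-complete r′ v (min-preserved v (isCompMin-sound r v e))))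
        (allFin n) (allFin⁺ n) (∈-allFin z)
        where
          z-not-isCompMin : isCompMin r z ≡ false
          z-not-isCompMin with isCompMin r z in e
          ... | false = refl
          ... | true  = ⊥-elim (z-not-min (isCompMin-sound r z e))

  -- The classes of r′ are those of r, except that the class of a and b splits into two; the larger of
  -- the two new minima is the one extra component minimum.
  split-components : ∀ (r r′ : Map n) a b →
    (∀ {u v} → Linked r u v → Bridged r′ a b u v) → (∀ {u v} → Linked r′ u v → Linked r u v) →
    Linked r a b → ¬ Linked r′ a b → numComponents r′ ≡ suc (numComponents r)
  split-components r r′ a b r⊆bridged r′⊆r a~b a≁b
    with <-cmp (toℕ (componentMin r′ a)) (toℕ (componentMin r′ b))
  ... | tri< a<b _ _ = SplitOrdered.components r r′ a b r⊆bridged r′⊆r a~b a<b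
  ... | tri> _ _ b<a = SplitOrdered.components r r′ b a (λ p → bridged-flip (r⊆bridged p)) r′⊆r (a~b ⁻¹) b<a
  ... | tri≈ _ same _ = ⊥-elim (a≁b ((componentMin-linked r′ a ⁻¹) ∙
                                      subst (λ m → Linked r′ m b) (sym (Fin.toℕ-injective same)) (componentMin-linked r′ b)))

module _ {n : ℕ} where

  ≡⇒linked : ∀ {r : Map n} {u v} → u ≡ v → Linked r u v
  ≡⇒linked refl = ε

  -- Being sent to m by r^n is invariant along edges, since r^n x is cyclic and r is injective on cycles.
  linked-to-fixed : ∀ (r : Map n) {m x} → r m ≡ m → Linked r x m → iter r n x ≡ m
  linked-to-fixed r {m} rm x~m =
    Equivalence.from (EqClosure.gfold ⇔-isEquivalence (λ x → iter r n x ≡ m) edge-invariant x~m) (iter-fixed r rm n)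
    where
      edge-invariant : ∀ {x y} → r x ≡ y → (iter r n x ≡ m) ⇔ (iter r n y ≡ m)
      edge-invariant {x} refl = mk⇔
        (λ e → trans (sym (iter-suc r n x)) (trans (cong r e) rm))
        (λ e → cyclic-injective r (iter-n-cyclic r x) (0 , rm) (trans (iter-suc r n x) (trans e (sym rm))))

  -- When j precedes m on a cycle, r ∘ (j m) cuts m out of that cycle as a new fixed point.
  detach-components : ∀ (r : Map n) {j m} → Cyclic r j → Cyclic r m → r j ≡ m → r m ≢ m →
                      numComponents (λ x → r (transpose j m x)) ≡ suc (numComponents r)
  detach-components r {j} {m} cj cm rj≡m rm≢m =
    split-components r r′ m j (EqClosure.fold (bridged-isEquivalence r′ m j) (λ { refl → r-edge _ }))
      (EqClosure.fold (EqClosure.isEquivalence _) (λ { refl → r′-edge _ }))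
      (subst (λ y → Linked r y j) rj≡m (edge j ⁻¹)) m≁j
    where
      r′ : Map n
      r′ x = r (transpose j m x)

      j≢m : j ≢ m
      j≢m refl = rm≢m rj≡m

      r′j : r′ j ≡ r m
      r′j = cong r (transpose-≡ˡ j m)

      r′m : r′ m ≡ m
      r′m = trans (cong r (transpose-≡ʳ j m)) rj≡m

      r′-other : ∀ x → x ≢ j → x ≢ m → r′ x ≡ r x
      r′-other x x≢j x≢m = cong r (transpose-≢ j m x x≢j x≢m)

      r-edge : ∀ x → Bridged r′ m j x (r x)
      r-edge x = by-cases (x ≟ j) (x ≟ m)
        where
          by-cases : Dec (x ≡ j) → Dec (x ≡ m) → Bridged r′ m j x (r x)
          by-cases (yes refl) _          = inj₂ (inj₂ (ε , ≡⇒linked (sym rj≡m)))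
          by-cases (no _)     (yes refl) = inj₂ (inj₁ (ε , subst (Linked r′ j) r′j (edge j)))
          by-cases (no x≢j)   (no x≢m)   = inj₁ (subst (Linked r′ x) (r′-other x x≢j x≢m) (edge x))

      r′-edge : ∀ x → Linked r x (r′ x)
      r′-edge x = by-cases (x ≟ j) (x ≟ m)
        where
          by-cases : Dec (x ≡ j) → Dec (x ≡ m) → Linked r x (r′ x)
          by-cases (yes refl) _          = subst (λ y → Linked r j (r y)) rj≡m (edge j ∙ edge (r j)) ∙ ≡⇒linked (sym r′j)
          by-cases (no _)     (yes refl) = ≡⇒linked (sym r′m)
          by-cases (no x≢j)   (no x≢m)   = subst (Linked r x) (sym (r′-other x x≢j x≢m)) (edge x)

      m≁j : ¬ Linked r′ m j
      m≁j m~j = j≢m (OnCycles.iter-injective r′ n (swapped-cyclic {r = r} {r′ = r′} (λ _ → refl) cj cm cj) (0 , r′m)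
                       (trans (linked-to-fixed r′ r′m (m~j ⁻¹)) (sym (iter-fixed r′ r′m n))))

  -- Each component contains exactly one cycle; here the cycles are fixed points, and r^n matches
  -- them with the component minima.
  numComponents-fixed-cycles : ∀ (r : Map n) → (∀ v → inCycle r v ≡ true → r v ≡ v) → numComponents r ≡ cycNodes r
  numComponents-fixed-cycles r cyclic-fixed =
    trans (Perm.↭-length minima↭cyclic) (List.length-map (componentMin r) (filterᵇ (inCycle r) (allFin n)))
    where
      minima↭cyclic : filterᵇ (isCompMin r) (allFin n) ↭ map (componentMin r) (filterᵇ (inCycle r) (allFin n))
      minima↭cyclic = filter-↭-map (allFin⁺ n) ∈-allFin (isCompMin r) (inCycle r) (componentMin r) (iter r n)
        (λ x e → inCycle-complete r _ (iter-n-cyclic r x) ,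
                 componentMin-unique r (isCompMin-sound r x e) (linked-iter r n x))
        (λ y e → isCompMin-complete r _ (componentMin-isMin r y) ,
                 linked-to-fixed r (cyclic-fixed y e) (componentMin-linked r y))

-- Ranks

module Rank {n : ℕ} (c : Fin n → Bool) where

  below : ℕ → ℕ
  below k = count (λ u → c u ∧ (toℕ u <ᵇ k)) (allFin n)

  rank : Fin n → ℕ
  rank v = below (toℕ v)

  total : ℕ
  total = count c (allFin n)

  private
    <ᵇ-true : ∀ {m k} → m < k → (m <ᵇ k) ≡ true
    <ᵇ-true {m} {k} = dec-true (m <? k)

    <ᵇ-false : ∀ {m k} → k ≤ m → (m <ᵇ k) ≡ false
    <ᵇ-false {m} {k} k≤m = dec-false (m <? k) (≤⇒≯ k≤m)

    <ᵇ-sound : ∀ {m k} → (m <ᵇ k) ≡ true → m < k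
    <ᵇ-sound {m} {k} e = <ᵇ⇒< m k (Equivalence.from T-≡ e)

  below-zero : below 0 ≡ 0
  below-zero = trans (count-cong _ (λ _ → false) (allFin n) (λ {u} _ → ∧≡falseʳ (c u) refl)) (none (allFin n))
    where
      none : ∀ xs → count (λ (_ : Fin n) → false) xs ≡ 0
      none []       = refl
      none (_ ∷ xs) = none xs

  below-n : below n ≡ total
  below-n = count-cong _ _ (allFin n) λ {u} _ → trans (cong (c u ∧_) (<ᵇ-true (Fin.toℕ<n u))) (∧-identityʳ (c u))

  below-strict : ∀ {k′ k} z → c z ≡ true → k′ ≤ toℕ z → toℕ z < k → suc (below k′) ≤ below k
  below-strict {k′} {k} z cz k′≤z z<k
    with count-⊆ (λ u → c u ∧ (toℕ u <ᵇ k′)) (λ u → c u ∧ (toℕ u <ᵇ k)) smaller⊆ (allFin n)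
    where
      smaller⊆ : ∀ u → c u ∧ (toℕ u <ᵇ k′) ≡ true → c u ∧ (toℕ u <ᵇ k) ≡ true
      smaller⊆ u e with ∧≡true⁻ (c u) e
      ... | cu , u<k′ = ∧≡true⁺ cu (<ᵇ-true (<-≤-trans (<ᵇ-sound u<k′) (≤-trans k′≤z (<⇒≤ z<k))))
  ... | inj₂ grows = grows
  ... | inj₁ same with () ← trans (sym (cong₂ _∧_ cz (<ᵇ-true z<k)))
                              (trans (same (∈-allFin z)) (cong₂ _∧_ cz (<ᵇ-false k′≤z)))

  rank-strict : ∀ {u v} → c u ≡ true → toℕ u < toℕ v → rank u < rank v
  rank-strict {u} cu u<v = below-strict u cu ≤-refl u<v

  rank-injective : ∀ {u v} → c u ≡ true → c v ≡ true → rank u ≡ rank v → u ≡ v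
  rank-injective {u} {v} cu cv e with <-cmp (toℕ u) (toℕ v)
  ... | tri< u<v _ _ = ⊥-elim (<-irrefl e (rank-strict cu u<v))
  ... | tri≈ _ u≡v _ = Fin.toℕ-injective u≡v
  ... | tri> _ _ v<u = ⊥-elim (<-irrefl (sym e) (rank-strict cv v<u))

  rank<total : ∀ {v} → c v ≡ true → rank v < total
  rank<total {v} cv = subst (rank v <_) below-n (below-strict v cv ≤-refl (Fin.toℕ<n v))

  private
    <ᵇ-suc : ∀ m k → m ≢ k → (m <ᵇ suc k) ≡ (m <ᵇ k)
    <ᵇ-suc zero    zero    0≢0 = ⊥-elim (0≢0 refl)
    <ᵇ-suc zero    (suc k) _   = refl
    <ᵇ-suc (suc m) zero    _   = refl
    <ᵇ-suc (suc m) (suc k) m≢k = <ᵇ-suc m k (λ e → m≢k (cong suc e))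

    below-step-≢ : ∀ v u → u ≢ v → c u ∧ (toℕ u <ᵇ suc (toℕ v)) ≡ c u ∧ (toℕ u <ᵇ toℕ v)
    below-step-≢ v u u≢v = cong (c u ∧_) (<ᵇ-suc (toℕ u) (toℕ v) (λ e → u≢v (Fin.toℕ-injective e)))

  below-step-marked : ∀ v → c v ≡ true → below (suc (toℕ v)) ≡ suc (below (toℕ v))
  below-step-marked v cv = count-insert _ _ v (∧≡true⁺ cv (<ᵇ-true {toℕ v} ≤-refl)) (∧≡falseʳ (c v) (<ᵇ-false {toℕ v} ≤-refl))
                                        (below-step-≢ v) (allFin n) (allFin⁺ n) (∈-allFin v)

  below-step-unmarked : ∀ v → c v ≡ false → below (suc (toℕ v)) ≡ below (toℕ v)
  below-step-unmarked v cv = count-cong _ _ (allFin n) λ {u} _ → at u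
    where
      at : ∀ u → c u ∧ (toℕ u <ᵇ suc (toℕ v)) ≡ c u ∧ (toℕ u <ᵇ toℕ v)
      at u with u Fin.≟ v
      ... | yes refl rewrite cv = refl
      ... | no u≢v  = below-step-≢ v u u≢v

  rank-surjective-below : ∀ k → k ≤ n → ∀ {t} → t < below k → ∃[ v ] c v ≡ true × rank v ≡ t
  rank-surjective-below zero    _   t<b = ⊥-elim (n≮0 (subst (_ <_) below-zero t<b))
  rank-surjective-below (suc k) k<n {t} t<b =
    step (fromℕ< k<n) (subst (λ m → t < below (suc m)) (sym (Fin.toℕ-fromℕ< k<n)) t<b)
         (λ lt → rank-surjective-below k (<⇒≤ k<n) (subst (λ m → t < below m) (Fin.toℕ-fromℕ< k<n) lt))
    where
      step : ∀ v → t < below (suc (toℕ v)) → (t < below (toℕ v) → ∃[ u ] c u ≡ true × rank u ≡ t) →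
             ∃[ u ] c u ≡ true × rank u ≡ t
      step v t<b′ earlier with c v in cv
      ... | false = earlier (subst (t <_) (below-step-unmarked v cv) t<b′)
      ... | true with t ℕ.≟ below (toℕ v)
      ...   | yes refl = v , cv , refl
      ...   | no t≢b   = earlier (≤∧≢⇒< (s≤s⁻¹ (subst (t <_) (below-step-marked v cv) t<b′)) t≢b)

  rank-surjective : ∀ {t} → t < total → ∃[ v ] c v ≡ true × rank v ≡ t
  rank-surjective t<total = rank-surjective-below n ≤-refl (subst (_ <_) (sym below-n) t<total)

  node : Fin n → ℕ → Fin n
  node d t with Fin.any? (λ v → (c v ≟ᵇ true) ×-dec (rank v ℕ.≟ t))
  ... | yes (v , _) = v
  ... | no _        = d

  node-spec : ∀ d {t} → t < total → c (node d t) ≡ true × rank (node d t) ≡ t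
  node-spec d {t} t<total with Fin.any? (λ v → (c v ≟ᵇ true) ×-dec (rank v ℕ.≟ t))
  ... | yes (_ , has-rank) = has-rank
  ... | no none            = ⊥-elim (none (rank-surjective t<total))

  node-unique : ∀ d {t v} → c v ≡ true → rank v ≡ t → node d t ≡ v
  node-unique d {t} {v} cv rv with node-spec d (subst (_< total) rv (rank<total cv))
  ... | cn , rn = rank-injective cn cv (trans rn (sym rv))

module _ {n : ℕ} {c c′ : Fin n → Bool} (c≗c′ : ∀ x → c x ≡ c′ x) where

  rank-cong : ∀ v → Rank.rank c v ≡ Rank.rank c′ v
  rank-cong v = count-cong _ _ (allFin n) (λ {u} _ → cong (_∧ (toℕ u <ᵇ toℕ v)) (c≗c′ u))

  node-cong : ∀ d {t} → t < Rank.total c → Rank.node c d t ≡ Rank.node c′ d t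
  node-cong d t<total with Rank.node-spec c d t<total
  ... | cv , rv = sym (Rank.node-unique c′ d (trans (sym (c≗c′ _)) cv) (trans (sym (rank-cong (Rank.node c d _))) rv))

module _ {n : ℕ} where

  Invariant : {B : Set} → (Map n → B) → Set
  Invariant f = ∀ {r s : Map n} → (∀ x → r x ≡ s x) → f r ≡ f s

  weight : (Map n → Bool) → (Map n → ℕ) → ℕ
  weight P W = sum (map W (filterᵇ P (allMaps n)))

  weight-indicator : ∀ P W → weight P W ≡ sum (map (λ r → if P r then W r else 0) (allMaps n))
  weight-indicator P W = sum-filterᵇ P W (allMaps n)

  private
    weight-vectors : ∀ P W → weight P W ≡ sum (map (λ v → W (lookup v)) (filterᵇ (λ v → P (lookup v)) (allVecs n n)))
    weight-vectors P W = trans (cong (λ rs → sum (map W rs)) (filterᵇ-map P lookup (allVecs n n)))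
                               (cong sum (sym (List.map-∘ (filterᵇ (λ v → P (lookup v)) (allVecs n n)))))

  -- Maps are enumerated as vectors, so an involution φ of maps, defined up to pointwise equality, is
  -- transported to a genuine involution of vectors.
  weight-involution : ∀ (P Q : Map n → Bool) (φ : Map n → Map n) → Invariant P → Invariant Q →
    (∀ {r s} → P r ≡ true ⊎ Q r ≡ true → (∀ x → r x ≡ s x) → ∀ x → φ r x ≡ φ s x) →
    (∀ r → P r ≡ true → Q (φ r) ≡ true × (∀ x → φ (φ r) x ≡ r x)) →
    (∀ r → Q r ≡ true → P (φ r) ≡ true × (∀ x → φ (φ r) x ≡ r x)) →
    ∀ W → Invariant W → weight P W ≡ weight Q (λ r → W (φ r))
  weight-involution P Q φ P-inv Q-inv φ-cong PQ QP W W-inv =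
    begin
      weight P W
    ≡⟨ weight-vectors P W ⟩
      sum (map (λ v → W (lookup v)) (filterᵇ (λ v → P (lookup v)) vecs))
    ≡⟨ sum-↭ (Perm.map⁺ _ (filter-↭-map (allVecs-unique n n) (allVecs-complete n n) _ _ φᵥ φᵥ
                             (swap-into Q-inv inj₂ PQ) (swap-into P-inv inj₁ QP))) ⟩
      sum (map (λ v → W (lookup v)) (map φᵥ (filterᵇ (λ v → Q (lookup v)) vecs)))
    ≡⟨ cong sum (sym (List.map-∘ (filterᵇ (λ v → Q (lookup v)) vecs))) ⟩
      sum (map (λ v → W (lookup (φᵥ v))) (filterᵇ (λ v → Q (lookup v)) vecs))
    ≡⟨ sum-map-cong (λ v → W-inv (Vec.lookup∘tabulate (φ (lookup v)))) (filterᵇ (λ v → Q (lookup v)) vecs) ⟩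
      sum (map (λ v → W (φ (lookup v))) (filterᵇ (λ v → Q (lookup v)) vecs))
    ≡⟨ sym (weight-vectors Q (λ r → W (φ r))) ⟩
      weight Q (λ r → W (φ r))
    ∎
    where
      open ≡-Reasoning
      vecs : List (Vec (Fin n) n)
      vecs = allVecs n n

      φᵥ : Vec (Fin n) n → Vec (Fin n) n
      φᵥ v = tabulate (φ (lookup v))

      swap-into : ∀ {R S : Map n → Bool} → Invariant S → (∀ {r} → S r ≡ true → P r ≡ true ⊎ Q r ≡ true) →
                  (∀ r → R r ≡ true → S (φ r) ≡ true × (∀ x → φ (φ r) x ≡ r x)) →
                  ∀ v → R (lookup v) ≡ true → S (lookup (φᵥ v)) ≡ true × φᵥ (φᵥ v) ≡ v
      swap-into {S = S} S-inv S⇒dom RS v Rv with RS (lookup v) Rv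
      ... | S-φr , φφr≗r = trans (S-inv lookup-φᵥ) S-φr ,
                           trans (Vec.tabulate-cong (λ x → trans (sym (φ-cong (S⇒dom S-φr) (λ y → sym (lookup-φᵥ y)) x))
                                                                 (φφr≗r x)))
                                 (Vec.tabulate∘lookup v)
        where
          lookup-φᵥ : ∀ x → lookup (φᵥ v) x ≡ φ (lookup v) x
          lookup-φᵥ = Vec.lookup∘tabulate (φ (lookup v))

  weight-cong : ∀ P {W W′} → (∀ r → P r ≡ true → W r ≡ W′ r) → weight P W ≡ weight P W′
  weight-cong P W≗W′ = sum-filterᵇ-cong P W≗W′ (allMaps n)

  weight-* : ∀ P a W → weight P (λ r → a * W r) ≡ a * weight P W
  weight-* P a W = sum-map-* a W (filterᵇ P (allMaps n))

  weight-pred-cong : ∀ {P Q} → (∀ r → P r ≡ Q r) → ∀ W → weight P W ≡ weight Q W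
  weight-pred-cong {P} {Q} P≗Q W = cong (λ rs → sum (map W rs))
    (List.filter-≐ (λ r → T? (P r)) (λ r → T? (Q r)) ((λ {r} → subst T (P≗Q r)) , (λ {r} → subst T (sym (P≗Q r))))
                   (allMaps n))

-- Double factorials

-- ∏_{j<k} (1 + j a): k! for a = 1 and (2k − 1)!! for a = 2.
multifactorial : ℕ → ℕ → ℕ
multifactorial a zero    = 1
multifactorial a (suc k) = (1 + k * a) * multifactorial a k

multifactorial-1 : ∀ k → multifactorial 1 k ≡ k !
multifactorial-1 zero    = refl
multifactorial-1 (suc k) = cong₂ _*_ (cong suc (*-identityʳ k)) (multifactorial-1 k)

evenDoubleFactorial : ℕ → ℕ
evenDoubleFactorial i = 2 ^ i * i !

wallis-lower : ∀ i → (1 + 2 * i) * (multifactorial 2 i * multifactorial 2 i) ≤ evenDoubleFactorial i * evenDoubleFactorial i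
wallis-lower zero    = ≤-refl
wallis-lower (suc i) =
  begin
    (1 + 2 * suc i) * (multifactorial 2 (suc i) * multifactorial 2 (suc i))
  ≡⟨ regroup i (multifactorial 2 i) ⟩
    ((3 + 2 * i) * (1 + 2 * i)) * ((1 + 2 * i) * (multifactorial 2 i * multifactorial 2 i))
  ≤⟨ *-mono-≤ (n≤1+n ((3 + 2 * i) * (1 + 2 * i))) (wallis-lower i) ⟩
    (1 + (3 + 2 * i) * (1 + 2 * i)) * (evenDoubleFactorial i * evenDoubleFactorial i)
  ≡⟨ square-step i (2 ^ i) (i !) ⟩
    evenDoubleFactorial (suc i) * evenDoubleFactorial (suc i)
  ∎
  where
    open ≤-Reasoning
    regroup : ∀ i d → (1 + 2 * (1 + i)) * (((1 + i * 2) * d) * ((1 + i * 2) * d)) ≡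
                      ((3 + 2 * i) * (1 + 2 * i)) * ((1 + 2 * i) * (d * d))
    regroup = solve-∀
    square-step : ∀ i p f → (1 + (3 + 2 * i) * (1 + 2 * i)) * ((p * f) * (p * f)) ≡
                            ((2 * p) * ((1 + i) * f)) * ((2 * p) * ((1 + i) * f))
    square-step = solve-∀

wallis-upper : ∀ i → evenDoubleFactorial (suc i) * evenDoubleFactorial (suc i) ≤
                     4 * suc i * (multifactorial 2 (suc i) * multifactorial 2 (suc i))
wallis-upper zero    = ≤-refl
wallis-upper (suc i) =
  begin
    evenDoubleFactorial (suc (suc i)) * evenDoubleFactorial (suc (suc i))
  ≡⟨ square-step i (2 ^ suc i) (suc i !) ⟩
    (4 * (2 + i) * (2 + i)) * (evenDoubleFactorial (suc i) * evenDoubleFactorial (suc i))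
  ≤⟨ *-monoʳ-≤ (4 * (2 + i) * (2 + i)) (wallis-upper i) ⟩
    (4 * (2 + i) * (2 + i)) * (4 * suc i * (D * D))
  ≡⟨ regroup i D ⟩
    (4 * (2 + i)) * ((4 * (1 + i) * (2 + i)) * (D * D))
  ≤⟨ *-monoʳ-≤ (4 * (2 + i)) (*-monoˡ-≤ (D * D) (n≤1+n (4 * (1 + i) * (2 + i)))) ⟩
    (4 * (2 + i)) * ((1 + 4 * (1 + i) * (2 + i)) * (D * D))
  ≡⟨ odd-square i D ⟩
    4 * suc (suc i) * (multifactorial 2 (suc (suc i)) * multifactorial 2 (suc (suc i)))
  ∎
  where
    open ≤-Reasoning
    D : ℕ
    D = multifactorial 2 (suc i)
    square-step : ∀ i p f → ((2 * p) * ((2 + i) * f)) * ((2 * p) * ((2 + i) * f)) ≡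
                            (4 * (2 + i) * (2 + i)) * ((p * f) * (p * f))
    square-step = solve-∀
    regroup : ∀ i d → (4 * (2 + i) * (2 + i)) * (4 * (1 + i) * (d * d)) ≡
                      (4 * (2 + i)) * ((4 * (1 + i) * (2 + i)) * (d * d))
    regroup = solve-∀
    odd-square : ∀ i d → (4 * (2 + i)) * ((1 + 4 * (1 + i) * (2 + i)) * (d * d)) ≡
                         4 * (2 + i) * (((1 + (1 + i) * 2) * d) * ((1 + (1 + i) * 2) * d))
    odd-square = solve-∀

multifactorial≢0 : ∀ a k → NonZero (multifactorial a k)
multifactorial≢0 a zero    = _
multifactorial≢0 a (suc k) = m*n≢0 (1 + k * a) (multifactorial a k) {{_}} {{multifactorial≢0 a k}}

evenDoubleFactorial≢0 : ∀ i → NonZero (evenDoubleFactorial i)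
evenDoubleFactorial≢0 i = m*n≢0 (2 ^ i) (i !) {{m^n≢0 2 i}} {{i !≢0}}

-- Squaring B S = D X turns bounds on (B / D)² into bounds on (X / S)².
ratio-bounds : ∀ B D S X i .{{_ : NonZero B}} .{{_ : NonZero D}} → B * S ≡ D * X →
               i * (D * D) ≤ B * B → B * B ≤ 4 * i * (D * D) →
               X ^ 2 ≤ 4 * (S ^ 2 * i) × S ^ 2 * i ≤ X ^ 2
ratio-bounds B D S X i BS≡DX lower upper = X²-bound , S²i-bound
  where
    open ≤-Reasoning

    X²-bound : X ^ 2 ≤ 4 * (S ^ 2 * i)
    X²-bound = *-cancelˡ-≤ (D * D) {{m*n≢0 D D}} (begin
      D * D * X ^ 2            ≡⟨ square-product D X ⟩
      (D * X) * (D * X)        ≡⟨ cong (λ y → y * y) (sym BS≡DX) ⟩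
      (B * S) * (B * S)        ≡⟨ product-square B S ⟩
      B * B * (S * S)          ≤⟨ *-monoˡ-≤ (S * S) upper ⟩
      4 * i * (D * D) * (S * S) ≡⟨ regroup i D S ⟩
      D * D * (4 * (S ^ 2 * i)) ∎)
      where
        square-product : ∀ d x → d * d * (x * (x * 1)) ≡ (d * x) * (d * x)
        square-product = solve-∀
        product-square : ∀ b s → (b * s) * (b * s) ≡ b * b * (s * s)
        product-square = solve-∀
        regroup : ∀ i d s → 4 * i * (d * d) * (s * s) ≡ d * d * (4 * ((s * (s * 1)) * i))
        regroup = solve-∀

    S²i-bound : S ^ 2 * i ≤ X ^ 2
    S²i-bound = *-cancelˡ-≤ (B * B) {{m*n≢0 B B}} (begin
      B * B * (S ^ 2 * i)      ≡⟨ regroup B S i ⟩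
      (B * S) * (B * S) * i    ≡⟨ cong (λ y → y * y * i) BS≡DX ⟩
      (D * X) * (D * X) * i    ≡⟨ regroup′ D X i ⟩
      i * (D * D) * X ^ 2      ≤⟨ *-monoˡ-≤ (X ^ 2) lower ⟩
      B * B * X ^ 2            ∎)
      where
        regroup : ∀ b s i → b * b * ((s * (s * 1)) * i) ≡ (b * s) * (b * s) * i
        regroup = solve-∀
        regroup′ : ∀ d x i → (d * x) * (d * x) * i ≡ i * (d * d) * (x * (x * 1))
        regroup′ = solve-∀

-- Layers of maps

-- d is a junk value making node total; it is never returned for the ranks below i that occur.
module Chain {n : ℕ} (d : Fin n) (i : ℕ) where

  rank : Map n → Fin n → ℕ
  rank r = Rank.rank (inCycle r)

  node : Map n → ℕ → Fin n
  node r = Rank.node (inCycle r) d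

  module Nodes {r : Map n} (ci : cycNodes r ≡ i) where

    node-cyclic : ∀ {t} → t < i → inCycle r (node r t) ≡ true
    node-cyclic t<i = proj₁ (Rank.node-spec (inCycle r) d (subst (_ <_) (sym ci) t<i))

    rank-node : ∀ {t} → t < i → rank r (node r t) ≡ t
    rank-node t<i = proj₂ (Rank.node-spec (inCycle r) d (subst (_ <_) (sym ci) t<i))

    node-unique : ∀ {t v} → inCycle r v ≡ true → rank r v ≡ t → node r t ≡ v
    node-unique = Rank.node-unique (inCycle r) d

    rank<i : ∀ {v} → inCycle r v ≡ true → rank r v < i
    rank<i cv = subst (_ <_) ci (Rank.rank<total (inCycle r) cv)

    node-injective : ∀ {t t′} → t < i → t′ < i → node r t ≡ node r t′ → t ≡ t′
    node-injective t<i t′<i e = trans (sym (rank-node t<i)) (trans (cong (rank r) e) (rank-node t′<i))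

    node-inCycle-cong : ∀ {s : Map n} → (∀ x → inCycle r x ≡ inCycle s x) → ∀ {t} → t < i → node r t ≡ node s t
    node-inCycle-cong r≈s t<i = node-cong r≈s d (subst (_ <_) (sym ci) t<i)

  FixedFrom : ℕ → Map n → Set
  FixedFrom k r = cycNodes r ≡ i × (∀ v → inCycle r v ≡ true → k ≤ rank r v → r v ≡ v)

  EnteredFrom : ℕ → ℕ → Map n → Set
  EnteredFrom k t r = FixedFrom (suc k) r × r (node r t) ≡ node r k

  fixedFrom? : ∀ k r → Dec (FixedFrom k r)
  fixedFrom? k r = (cycNodes r ℕ.≟ i) ×-dec
                   Fin.all? (λ v → (inCycle r v ≟ᵇ true) →-dec ((k ≤? rank r v) →-dec (r v ≟ v)))

  enteredFrom? : ∀ k t r → Dec (EnteredFrom k t r)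
  enteredFrom? k t r = fixedFrom? (suc k) r ×-dec (r (node r t) ≟ node r k)

  fixedFrom : ℕ → Map n → Bool
  fixedFrom k r = ⌊ fixedFrom? k r ⌋

  enteredFrom : ℕ → ℕ → Map n → Bool
  enteredFrom k t r = ⌊ enteredFrom? k t r ⌋

  fixedFrom-suc : ∀ {k r} → FixedFrom k r → FixedFrom (suc k) r
  fixedFrom-suc (ci , fixed) = ci , λ v cv k<rank → fixed v cv (≤-trans (n≤1+n _) k<rank)

  fixedFrom-≗ : ∀ {k} {r s : Map n} → (∀ x → r x ≡ s x) → FixedFrom k r → FixedFrom k s
  fixedFrom-≗ {k} {r} {s} r≗s (ci , fixed) =
    trans (sym (cycNodes-cong {r = r} {s = s} r≈s)) ci ,
    λ v cv k≤rank → trans (sym (r≗s v)) (fixed v (trans (r≈s v) cv) (subst (k ≤_) (sym (rank-cong r≈s v)) k≤rank))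
    where
      r≈s : ∀ x → inCycle r x ≡ inCycle s x
      r≈s = inCycle-cong r≗s

  fixedFrom-invariant : ∀ k → Invariant (fixedFrom k)
  fixedFrom-invariant k {r} {s} r≗s = bool-ext
    (λ e → ⌊⌋-complete (fixedFrom? k s) (fixedFrom-≗ r≗s (⌊⌋-sound (fixedFrom? k r) e)))
    (λ e → ⌊⌋-complete (fixedFrom? k r) (fixedFrom-≗ (λ x → sym (r≗s x)) (⌊⌋-sound (fixedFrom? k s) e)))

  module Layer {k : ℕ} (k<i : k < i) {r : Map n} (in-layer : FixedFrom (suc k) r) where

    open Nodes {r} (proj₁ in-layer)

    m : Fin n
    m = node r k

    private
      cyclic-node : ∀ {t} → t < i → Cyclic r (node r t)
      cyclic-node t<i = inCycle-sound r _ (node-cyclic t<i)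

      enters-m⇒≡ : ∀ {t v} → t < i → Cyclic r v → r (node r t) ≡ m → r v ≡ m → node r t ≡ v
      enters-m⇒≡ t<i cv e e′ = cyclic-injective r (cyclic-node t<i) cv (trans e (sym e′))

    m-fixed : r m ≡ m → FixedFrom k r × (∀ t → t < k → ¬ EnteredFrom k t r)
    m-fixed rm≡m = (proj₁ in-layer , fixed) , λ t t<k (_ , e) →
      <-irrefl (node-injective (<-trans t<k k<i) k<i (enters-m⇒≡ (<-trans t<k k<i) (cyclic-node k<i) e rm≡m)) t<k
      where
        fixed : ∀ v → inCycle r v ≡ true → k ≤ rank r v → r v ≡ v
        fixed v cv k≤rank with k ℕ.≟ rank r v
        ... | yes k≡rank rewrite sym (node-unique cv (sym k≡rank)) = rm≡m
        ... | no k≢rank  = proj₂ in-layer v cv (≤∧≢⇒< k≤rank k≢rank)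

    m-moving : r m ≢ m → ¬ FixedFrom k r × ∃[ t₀ ] t₀ < k × EnteredFrom k t₀ r ×
                                             (∀ t → t < k → t ≢ t₀ → ¬ EnteredFrom k t r)
    m-moving rm≢m = not-fixed , rank r p , rank-p<k , (in-layer , p-enters) , unique
      where
        not-fixed : ¬ FixedFrom k r
        not-fixed (_ , fixed) = rm≢m (fixed m (node-cyclic k<i) (≤-reflexive (sym (rank-node k<i))))

        period : ℕ
        period = proj₁ (cyclic-node k<i)

        p : Fin n
        p = iter r period m

        rp≡m : r p ≡ m
        rp≡m = proj₂ (cyclic-node k<i)

        cp : Cyclic r p
        cp = cyclic-iter r period (cyclic-node k<i)

        p≢m : p ≢ m
        p≢m p≡m = rm≢m (trans (cong r (sym p≡m)) rp≡m)

        rank-p<k : rank r p < k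
        rank-p<k with <-cmp (rank r p) k
        ... | tri< lt _ _ = lt
        ... | tri≈ _ eq _ = ⊥-elim (p≢m (sym (node-unique (inCycle-complete r p cp) eq)))
        ... | tri> _ _ gt = ⊥-elim (p≢m (trans (sym (proj₂ in-layer p (inCycle-complete r p cp) gt)) rp≡m))

        p-enters : r (node r (rank r p)) ≡ m
        p-enters = trans (cong r (node-unique (inCycle-complete r p cp) refl)) rp≡m

        unique : ∀ t → t < k → t ≢ rank r p → ¬ EnteredFrom k t r
        unique t t<k t≢ (_ , e) = t≢ (trans (sym (rank-node (<-trans t<k k<i)))
                                            (cong (rank r) (enters-m⇒≡ (<-trans t<k k<i) cp e rp≡m)))

  fixedFrom-false : ∀ {k r} → ¬ FixedFrom k r → fixedFrom k r ≡ false
  fixedFrom-false {k} {r} = ⌊⌋-false (fixedFrom? k r)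

  enteredFrom-false : ∀ {k t r} → ¬ EnteredFrom k t r → enteredFrom k t r ≡ false
  enteredFrom-false {k} {t} {r} = ⌊⌋-false (enteredFrom? k t r)

  split-indicator : ∀ {k} → k < i → ∀ r F →
    (if fixedFrom (suc k) r then F else 0) ≡
    (if fixedFrom k r then F else 0) + Σ< k (λ t → if enteredFrom k t r then F else 0)
  split-indicator {k} k<i r F = if-split k F present absent
    where
      absent : fixedFrom (suc k) r ≡ false → fixedFrom k r ≡ false × (∀ t → t < k → enteredFrom k t r ≡ false)
      absent e = fixedFrom-false (λ A → ¬in-layer (fixedFrom-suc A)) , λ t _ → enteredFrom-false (λ E → ¬in-layer (proj₁ E))
        where
          ¬in-layer : ¬ FixedFrom (suc k) r
          ¬in-layer = ⌊⌋-false⁻ (fixedFrom? (suc k) r) e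

      present : fixedFrom (suc k) r ≡ true →
        (fixedFrom k r ≡ true × (∀ t → t < k → enteredFrom k t r ≡ false)) ⊎
        (fixedFrom k r ≡ false × ∃[ t₀ ] t₀ < k × enteredFrom k t₀ r ≡ true ×
                                  (∀ t → t < k → t ≢ t₀ → enteredFrom k t r ≡ false))
      present e with ⌊⌋-sound (fixedFrom? (suc k) r) e
      ... | in-layer with r (Layer.m k<i in-layer) ≟ Layer.m k<i in-layer
      ...   | yes rm≡m = let (previous , ¬entered) = Layer.m-fixed k<i in-layer rm≡m in
                         inj₁ (⌊⌋-complete (fixedFrom? k r) previous , λ t t<k → enteredFrom-false (¬entered t t<k))
      ...   | no rm≢m  = let (¬previous , t₀ , t₀<k , entered , others) = Layer.m-moving k<i in-layer rm≢m in
                         inj₂ (fixedFrom-false ¬previous , t₀ , t₀<k , ⌊⌋-complete (enteredFrom? k t₀ r) entered ,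
                               λ t t<k t≢t₀ → enteredFrom-false (others t t<k t≢t₀))

  weight-split : ∀ {k} → k < i → ∀ W →
    weight (fixedFrom (suc k)) W ≡ weight (fixedFrom k) W + Σ< k (λ t → weight (enteredFrom k t) W)
  weight-split {k} k<i W =
    begin
      weight (fixedFrom (suc k)) W
    ≡⟨ weight-indicator (fixedFrom (suc k)) W ⟩
      sum (map (λ r → if fixedFrom (suc k) r then W r else 0) (allMaps n))
    ≡⟨ sum-map-cong (λ r → split-indicator k<i r (W r)) (allMaps n) ⟩
      sum (map (λ r → (if fixedFrom k r then W r else 0) + Σ< k (indicator r)) (allMaps n))
    ≡⟨ sum-map-+ (λ r → if fixedFrom k r then W r else 0) (λ r → Σ< k (indicator r)) (allMaps n) ⟩
      sum (map (λ r → if fixedFrom k r then W r else 0) (allMaps n)) + sum (map (λ r → Σ< k (indicator r)) (allMaps n))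
    ≡⟨ cong₂ _+_ (sym (weight-indicator (fixedFrom k) W)) (sum-Σ< k (λ t r → indicator r t) (allMaps n)) ⟩
      weight (fixedFrom k) W + Σ< k (λ t → sum (map (λ r → indicator r t) (allMaps n)))
    ≡⟨ cong (weight (fixedFrom k) W +_) (Σ<-cong k (λ t _ → sym (weight-indicator (enteredFrom k t) W))) ⟩
      weight (fixedFrom k) W + Σ< k (λ t → weight (enteredFrom k t) W)
    ∎
    where
      open ≡-Reasoning
      indicator : Map n → ℕ → ℕ
      indicator r t = if enteredFrom k t r then W r else 0

  -- Exchanging the images of the nodes of ranks t and k: cuts the node of rank k out of its cycle
  -- when it is entered from the node of rank t, and reinserts it there when it is fixed.
  swapNodes : ℕ → ℕ → Map n → Map n
  swapNodes t k r x = r (transpose (node r t) (node r k) x)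

  module SwapNodes {t k : ℕ} (t<k : t < k) (k<i : k < i) where

    t<i : t < i
    t<i = <-trans t<k k<i

    module _ {r : Map n} (ci : cycNodes r ≡ i) where

      open Nodes {r} ci

      private
        j m : Fin n
        j = node r t
        m = node r k

        s : Map n
        s = swapNodes t k r

        cj : Cyclic r j
        cj = inCycle-sound r j (node-cyclic t<i)

        cm : Cyclic r m
        cm = inCycle-sound r m (node-cyclic k<i)

      j≢m : j ≢ m
      j≢m e = <-irrefl (node-injective t<i k<i e) t<k

      swap-inCycle : ∀ x → inCycle s x ≡ inCycle r x
      swap-inCycle = inCycle-swapped {r = r} {r′ = s} (λ _ → refl) cj cm

      swap-cycNodes : cycNodes s ≡ i
      swap-cycNodes = trans (cycNodes-cong {r = s} {s = r} swap-inCycle) ci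

      swap-rank : ∀ v → rank s v ≡ rank r v
      swap-rank = rank-cong {c = inCycle s} {c′ = inCycle r} swap-inCycle

      swap-node : ∀ {t′} → t′ < i → node s t′ ≡ node r t′
      swap-node t′<i = sym (node-inCycle-cong {s = s} (λ x → sym (swap-inCycle x)) t′<i)

      swap-involutive : ∀ x → swapNodes t k s x ≡ r x
      swap-involutive x = trans (cong₂ (λ a b → s (transpose a b x)) (swap-node t<i) (swap-node k<i))
                                (cong r (transpose-involutive j m x))

      swap-cong : ∀ {r′ : Map n} → (∀ x → r x ≡ r′ x) → ∀ x → s x ≡ swapNodes t k r′ x
      swap-cong {r′} r≗r′ x = trans (r≗r′ _) (cong₂ (λ a b → r′ (transpose a b x)) (same t<i) (same k<i))
        where
          same : ∀ {t′} → t′ < i → node r t′ ≡ node r′ t′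
          same = node-inCycle-cong {s = r′} (inCycle-cong {r = r} {s = r′} r≗r′)

      entered⇒fixed : EnteredFrom k t r → FixedFrom k s
      entered⇒fixed (in-layer , rj≡m) = swap-cycNodes , fixed
        where
          fixed : ∀ v → inCycle s v ≡ true → k ≤ rank s v → s v ≡ v
          fixed v cv k≤rank = by-cases (v ≟ m)
            where
              cv′ : inCycle r v ≡ true
              cv′ = trans (sym (swap-inCycle v)) cv
              k≤rank′ : k ≤ rank r v
              k≤rank′ = subst (k ≤_) (swap-rank v) k≤rank

              by-cases : Dec (v ≡ m) → s v ≡ v
              by-cases (yes refl) = trans (cong r (transpose-≡ʳ j m)) rj≡m
              by-cases (no v≢m)   = trans (cong r (transpose-≢ j m v v≢j v≢m)) (proj₂ in-layer v cv′ k<rank)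
                where
                  k<rank : suc k ≤ rank r v
                  k<rank = ≤∧≢⇒< k≤rank′ (λ k≡rank → v≢m (sym (node-unique cv′ (sym k≡rank))))
                  v≢j : v ≢ j
                  v≢j refl = <-irrefl refl (<-≤-trans t<k (subst (k ≤_) (rank-node t<i) k≤rank′))

      fixed⇒entered : FixedFrom k r → EnteredFrom k t s
      fixed⇒entered (_ , fixed) = (swap-cycNodes , fixed′) , s-enters
        where
          m-fixed : r m ≡ m
          m-fixed = fixed m (node-cyclic k<i) (≤-reflexive (sym (rank-node k<i)))

          fixed′ : ∀ v → inCycle s v ≡ true → suc k ≤ rank s v → s v ≡ v
          fixed′ v cv k<rank = trans (cong r (transpose-≢ j m v v≢j v≢m)) (fixed v cv′ (<⇒≤ k<rank′))
            where
              cv′ : inCycle r v ≡ true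
              cv′ = trans (sym (swap-inCycle v)) cv
              k<rank′ : suc k ≤ rank r v
              k<rank′ = subst (suc k ≤_) (swap-rank v) k<rank
              v≢m : v ≢ m
              v≢m refl = <-irrefl (sym (rank-node k<i)) k<rank′
              v≢j : v ≢ j
              v≢j refl = <-irrefl (sym (rank-node t<i)) (<-trans t<k k<rank′)

          s-enters : s (node s t) ≡ node s k
          s-enters = trans (cong s (swap-node t<i))
                           (trans (cong r (transpose-≡ˡ j m)) (trans m-fixed (sym (swap-node k<i))))

      entered-components : EnteredFrom k t r → numComponents s ≡ suc (numComponents r)
      entered-components (_ , rj≡m) = detach-components r cj cm rj≡m rm≢m
        where
          rm≢m : r m ≢ m
          rm≢m rm≡m = j≢m (cyclic-injective r cj cm (trans rj≡m (sym rm≡m)))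

    enteredFrom-≗ : ∀ {r s : Map n} → (∀ x → r x ≡ s x) → EnteredFrom k t r → EnteredFrom k t s
    enteredFrom-≗ {r} {s} r≗s (in-layer , e) =
      fixedFrom-≗ r≗s in-layer ,
      trans (cong s (sym (same t<i))) (trans (sym (r≗s _)) (trans e (same k<i)))
      where
        same : ∀ {t′} → t′ < i → node r t′ ≡ node s t′
        same = Nodes.node-inCycle-cong {r} (proj₁ in-layer) {s = s} (inCycle-cong {r = r} {s = s} r≗s)

    enteredFrom-invariant : Invariant (enteredFrom k t)
    enteredFrom-invariant {r} {s} r≗s = bool-ext
      (λ e → ⌊⌋-complete (enteredFrom? k t s) (enteredFrom-≗ r≗s (⌊⌋-sound (enteredFrom? k t r) e)))
      (λ e → ⌊⌋-complete (enteredFrom? k t r) (enteredFrom-≗ (λ x → sym (r≗s x)) (⌊⌋-sound (enteredFrom? k t s) e)))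

    weight-entered : ∀ W → Invariant W → weight (enteredFrom k t) W ≡ weight (fixedFrom k) (λ r → W (swapNodes t k r))
    weight-entered = weight-involution (enteredFrom k t) (fixedFrom k) (swapNodes t k)
      enteredFrom-invariant (fixedFrom-invariant k) swap-cong′ entered⇒fixed′ fixed⇒entered′
      where
        swap-cong′ : ∀ {r r′} → enteredFrom k t r ≡ true ⊎ fixedFrom k r ≡ true → (∀ x → r x ≡ r′ x) →
                     ∀ x → swapNodes t k r x ≡ swapNodes t k r′ x
        swap-cong′ {r} {r′} (inj₁ e) = swap-cong {r} (proj₁ (proj₁ (⌊⌋-sound (enteredFrom? k t r) e))) {r′}
        swap-cong′ {r} {r′} (inj₂ e) = swap-cong {r} (proj₁ (⌊⌋-sound (fixedFrom? k r) e)) {r′}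

        entered⇒fixed′ : ∀ r → enteredFrom k t r ≡ true →
                         fixedFrom k (swapNodes t k r) ≡ true × (∀ x → swapNodes t k (swapNodes t k r) x ≡ r x)
        entered⇒fixed′ r e = ⌊⌋-complete (fixedFrom? k (swapNodes t k r)) (entered⇒fixed {r} ci E) , swap-involutive {r} ci
          where
            E : EnteredFrom k t r
            E = ⌊⌋-sound (enteredFrom? k t r) e
            ci : cycNodes r ≡ i
            ci = proj₁ (proj₁ E)

        fixed⇒entered′ : ∀ r → fixedFrom k r ≡ true →
                         enteredFrom k t (swapNodes t k r) ≡ true × (∀ x → swapNodes t k (swapNodes t k r) x ≡ r x)
        fixed⇒entered′ r e = ⌊⌋-complete (enteredFrom? k t (swapNodes t k r)) (fixed⇒entered {r} ci F) , swap-involutive {r} ci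
          where
            F : FixedFrom k r
            F = ⌊⌋-sound (fixedFrom? k r) e
            ci : cycNodes r ≡ i
            ci = proj₁ F

  -- Layer k + 1 is layer k together with k swapped copies of it, each weighted by a factor a.
  weight-layers : ∀ a W → Invariant W →
    (∀ {t k} → t < k → k < i → ∀ r → fixedFrom k r ≡ true → W (swapNodes t k r) ≡ a * W r) →
    ∀ k → k ≤ i → weight (fixedFrom k) W ≡ multifactorial a k * weight (fixedFrom 0) W
  weight-layers a W W-inv W-swap zero    _   = sym (*-identityˡ _)
  weight-layers a W W-inv W-swap (suc k) k<i =
    begin
      weight (fixedFrom (suc k)) W
    ≡⟨ weight-split k<i W ⟩
      Wk + Σ< k (λ t → weight (enteredFrom k t) W)
    ≡⟨ cong (Wk +_) (Σ<-cong k entered-weight) ⟩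
      Wk + Σ< k (λ _ → a * Wk)
    ≡⟨ cong (Wk +_) (trans (Σ<-const k (a * Wk)) (sym (*-assoc k a Wk))) ⟩
      (1 + k * a) * Wk
    ≡⟨ cong ((1 + k * a) *_) (weight-layers a W W-inv W-swap k (<⇒≤ k<i)) ⟩
      (1 + k * a) * (multifactorial a k * weight (fixedFrom 0) W)
    ≡⟨ sym (*-assoc (1 + k * a) (multifactorial a k) _) ⟩
      multifactorial a (suc k) * weight (fixedFrom 0) W
    ∎
    where
      open ≡-Reasoning
      Wk : ℕ
      Wk = weight (fixedFrom k) W

      entered-weight : ∀ t → t < k → weight (enteredFrom k t) W ≡ a * Wk
      entered-weight t t<k = trans (SwapNodes.weight-entered t<k k<i W W-inv)
                                   (trans (weight-cong (fixedFrom k) (W-swap t<k k<i)) (weight-* (fixedFrom k) a W))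

  event : Map n → Bool
  event r = ⌊ cycNodes r ℕ.≟ i ⌋

  fixedFrom-i≡event : ∀ r → fixedFrom i r ≡ event r
  fixedFrom-i≡event r = bool-ext
    (λ e → ⌊⌋-complete (cycNodes r ℕ.≟ i) (proj₁ (⌊⌋-sound (fixedFrom? i r) e)))
    (λ e → let ci = ⌊⌋-sound (cycNodes r ℕ.≟ i) e in
           ⌊⌋-complete (fixedFrom? i r) (ci , λ v cv i≤rank → ⊥-elim (<-irrefl refl (<-≤-trans (Nodes.rank<i {r} ci cv) i≤rank))))

  fixedFrom-0-components : ∀ r → fixedFrom 0 r ≡ true → numComponents r ≡ i
  fixedFrom-0-components r e with ⌊⌋-sound (fixedFrom? 0 r) e
  ... | ci , fixed = trans (numComponents-fixed-cycles r (λ v cv → fixed v cv z≤n)) ci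

  componentWeight : Map n → ℕ
  componentWeight r = 2 ^ (n ∸ numComponents r)

  componentWeight-swap : ∀ {t k} → t < k → k < i → ∀ r → fixedFrom k r ≡ true →
                         componentWeight (swapNodes t k r) ≡ 2 * componentWeight r
  componentWeight-swap {t} {k} t<k k<i r e =
    cong (2 ^_) (trans (+-∸-assoc 1 {n} {suc (numComponents s)} (subst (_≤ n) one-more (numComponents-≤ r)))
                       (cong (λ c → suc (n ∸ c)) (sym one-more)))
    where
      open SwapNodes t<k k<i

      F : FixedFrom k r
      F = ⌊⌋-sound (fixedFrom? k r) e

      s : Map n
      s = swapNodes t k r

      one-more : numComponents r ≡ suc (numComponents s)
      one-more = trans (sym (numComponents-cong {r = swapNodes t k s} {s = r} (swap-involutive {r} (proj₁ F))))
                       (entered-components {s} (swap-cycNodes {r} (proj₁ F)) (fixed⇒entered {r} (proj₁ F) F))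

  eventSize≡factorial : eventSize n i ≡ i ! * weight (fixedFrom 0) (λ _ → 1)
  eventSize≡factorial =
    begin
      eventSize n i
    ≡⟨ sym (sum-map-1 (mapsWithCyc n i)) ⟩
      weight event (λ _ → 1)
    ≡⟨ weight-pred-cong {P = event} {Q = fixedFrom i} (λ r → sym (fixedFrom-i≡event r)) (λ _ → 1) ⟩
      weight (fixedFrom i) (λ _ → 1)
    ≡⟨ weight-layers 1 (λ _ → 1) (λ _ → refl) (λ _ _ _ _ → refl) i ≤-refl ⟩
      multifactorial 1 i * weight (fixedFrom 0) (λ _ → 1)
    ≡⟨ cong (_* weight (fixedFrom 0) (λ _ → 1)) (multifactorial-1 i) ⟩
      i ! * weight (fixedFrom 0) (λ _ → 1)
    ∎
    where open ≡-Reasoning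

  scaledSum≡multifactorial : scaledSum n i ≡ multifactorial 2 i * (2 ^ (n ∸ i) * weight (fixedFrom 0) (λ _ → 1))
  scaledSum≡multifactorial =
    begin
      weight event componentWeight
    ≡⟨ weight-pred-cong {P = event} {Q = fixedFrom i} (λ r → sym (fixedFrom-i≡event r)) componentWeight ⟩
      weight (fixedFrom i) componentWeight
    ≡⟨ weight-layers 2 componentWeight (λ {r} {s} r≗s → cong (λ c → 2 ^ (n ∸ c)) (numComponents-cong {r = r} {s = s} r≗s))
                     componentWeight-swap i ≤-refl ⟩
      multifactorial 2 i * weight (fixedFrom 0) componentWeight
    ≡⟨ cong (multifactorial 2 i *_) (trans (weight-cong (fixedFrom 0) {W′ = λ _ → 2 ^ (n ∸ i) * 1}
                                              (λ r e → trans (cong (λ c → 2 ^ (n ∸ c)) (fixedFrom-0-components r e)) (sym (*-identityʳ _))))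
                                            (weight-* (fixedFrom 0) (2 ^ (n ∸ i)) (λ _ → 1))) ⟩
      multifactorial 2 i * (2 ^ (n ∸ i) * weight (fixedFrom 0) (λ _ → 1))
    ∎
    where open ≡-Reasoning

  scaledSum-eventSize : i ≤ n → evenDoubleFactorial i * scaledSum n i ≡ multifactorial 2 i * (2 ^ n * eventSize n i)
  scaledSum-eventSize i≤n =
    begin
      (2 ^ i * i !) * scaledSum n i
    ≡⟨ cong ((2 ^ i * i !) *_) scaledSum≡multifactorial ⟩
      (2 ^ i * i !) * (multifactorial 2 i * (2 ^ (n ∸ i) * C₀))
    ≡⟨ regroup (2 ^ i) (i !) (multifactorial 2 i) (2 ^ (n ∸ i)) C₀ ⟩
      multifactorial 2 i * ((2 ^ i * 2 ^ (n ∸ i)) * (i ! * C₀))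
    ≡⟨ cong₂ (λ p e → multifactorial 2 i * (p * e))
             (trans (sym (^-distribˡ-+-* 2 i (n ∸ i))) (cong (2 ^_) (m+[n∸m]≡n i≤n))) (sym eventSize≡factorial) ⟩
      multifactorial 2 i * (2 ^ n * eventSize n i)
    ∎
    where
      open ≡-Reasoning
      C₀ : ℕ
      C₀ = weight (fixedFrom 0) (λ _ → 1)
      regroup : ∀ p f d q c → (p * f) * (d * (q * c)) ≡ d * ((p * q) * (f * c))
      regroup = solve-∀

lemma4p9 : (n i : ℕ) → 1 ≤ i → i ≤ n →
    ((2 ^ n * eventSize n i) ^ 2 ≤ 16 * (scaledSum n i ^ 2 * i))
    × (scaledSum n i ^ 2 * i ≤ (2 ^ n * eventSize n i) ^ 2)
lemma4p9 zero    (suc _) _ ()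
lemma4p9 (suc n) (suc j) _ i≤n = ≤-trans (proj₁ bounds) (*-monoˡ-≤ (S ^ 2 * i) 4≤16) , proj₂ bounds
  where
    i S X D : ℕ
    i = suc j
    S = scaledSum (suc n) i
    X = 2 ^ suc n * eventSize (suc n) i
    D = multifactorial 2 i

    4≤16 : 4 ≤ 16
    4≤16 = s≤s (s≤s (s≤s (s≤s z≤n)))

    i≤1+2i : i ≤ 1 + 2 * i
    i≤1+2i = ≤-trans (m≤n*m i 2) (n≤1+n (2 * i))

    bounds : X ^ 2 ≤ 4 * (S ^ 2 * i) × S ^ 2 * i ≤ X ^ 2
    bounds = ratio-bounds (evenDoubleFactorial i) D S X i {{evenDoubleFactorial≢0 i}} {{multifactorial≢0 2 i}}
               (Chain.scaledSum-eventSize fzero i i≤n)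
               (≤-trans (*-monoˡ-≤ (D * D) i≤1+2i) (wallis-lower i))
               (wallis-upper j)
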